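{- Let $m,n,r$ be positive integers and $\mu$ a partition with $(m,n)\notin\mu$. For $0\le l\le r-1$ set $$\alpha(l)=(\mu_1-m,\dots,\mu_{n-1}-m,\,l),\qquad\beta(l)=(\mu'_1-n,\dots,\mu'_{m-1}-n,\,r-1-l).$$ Then $(\delta,\gamma)\mapsto(\langle m^n\rangle+\delta)\cup\gamma'$ is a one-to-one correspondence from the set of pairs of partitions $(\delta,\gamma)$ such that, for some $0\le l\le r-1$, $\delta+\rho_n$ is a rearrangement of $\alpha(l)+\rho_n$ and $\gamma+\rho_m$ is a rearrangement of $\beta(l)+\rho_m$, onto the set of partitions $\lambda$ such that $\lambda\setminus\mu$ is an $r$-ribbon and $(m,n)\in\lambda$. Moreover, if $\lambda$ corresponds to the parameter $l$, the product of the signs of the permutations sorting $\alpha(l)+\rho_n$ and $\beta(l)+\rho_m$ into strictly decreasing sequences equals $(-1)^{r-1-l}(-1)^{\mathrm{ht}(\lambda\setminus\mu)}$.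
   Context: Partitions are non-increasing sequences of non-negative integers; $\mu'$ is the conjugate; the Ferrers diagram of $\mu$ is $\{(i,j):1\le i\le\mu_j\}$ and $(m,n)\in\mu$ means $\mu_n\ge m$. $\rho_j=(j-1,\dots,1,0)$; $\langle m^n\rangle$ is the partition with $n$ parts equal to $m$; sums are entrywise and $\cup$ is concatenation. For partitions $\mu\subset\lambda$, $\lambda\setminus\mu$ is an $r$-ribbon if it consists of $r$ boxes, is edgewise connected and contains no $2\times2$ block; its height $\mathrm{ht}$ is one less than the number of rows it occupies. -}

module Defs where

open import Data.Nat as ℕ using (ℕ; zero; suc; _+_; _∸_; _≤_; _<_)
open import Data.Integer as ℤ using (ℤ; +_; -_) renaming (_+_ to _+ℤ_; _-_ to _-ℤ_; _<_ to _<ℤ_)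
open import Data.Fin as Fin using (Fin; toℕ)
open import Data.Fin.Permutation using (Permutation′; _⟨$⟩ʳ_)
open import Data.List using (List; []; _∷_; length; map; filter; upTo; _++_; allFin; concatMap)
open import Data.Nat.ListAction using (sum)
open import Data.List.Relation.Unary.All using (All)
open import Data.List.Relation.Unary.Linked using (Linked)
open import Data.Product using (Σ; ∃; _×_; _,_)
open import Data.Sum using (_⊎_)
open import Data.Bool using (if_then_else_)
open import Relation.Nullary using (¬_)
open import Relation.Nullary.Decidable using (⌊_⌋)
open import Relation.Binary.PropositionalEquality using (_≡_)

-- Partitions: lists of POSITIVE naturals in non-increasing order
-- (canonical representation, trailing zeros omitted).

IsPartition : List ℕ → Set
IsPartition xs = Linked (λ a b → b ≤ a) xs × All (λ a → 1 ≤ a) xs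

-- 1-indexed part: part μ j = μ_j, with μ_j = 0 for j = 0 or j > length μ.
part : List ℕ → ℕ → ℕ
part xs zero = 0
part [] (suc j) = 0
part (x ∷ xs) (suc zero) = x
part (x ∷ xs) (suc (suc j)) = part xs (suc j)

oneTo : ℕ → List ℕ
oneTo k = map suc (upTo k)

conj : List ℕ → List ℕ
conj xs = map (λ j → length (filter (λ x → j ℕ.≤? x) xs)) (oneTo (part xs 1))

ρ : (k : ℕ) → Fin k → ℕ
ρ k i = k ∸ suc (toℕ i)

-- a partition with at most k parts, viewed as a length-k vector (padded by 0)
vec : (k : ℕ) → List ℕ → Fin k → ℕ
vec k xs i = part xs (suc (toℕ i))

αρ : (m n : ℕ) → List ℕ → ℕ → Fin n → ℤ
αρ m n μ l i =
  (if ⌊ suc (toℕ i) ℕ.≟ n ⌋ then + l else (+ part μ (suc (toℕ i)) -ℤ + m))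
  +ℤ + ρ n i

βρ : (m n r : ℕ) → List ℕ → ℕ → Fin m → ℤ
βρ m n r μ l i =
  (if ⌊ suc (toℕ i) ℕ.≟ m ⌋ then + (r ∸ 1 ∸ l) else (+ part (conj μ) (suc (toℕ i)) -ℤ + n))
  +ℤ + ρ m i

IsRearrangement : {k : ℕ} → (Fin k → ℤ) → (Fin k → ℤ) → Set
IsRearrangement {k} a b = Σ (Permutation′ k) λ π → ∀ i → a i ≡ b (π ⟨$⟩ʳ i)

Sorts : {k : ℕ} → (Fin k → ℤ) → Permutation′ k → Set
Sorts a σ = ∀ i j → i Fin.< j → a (σ ⟨$⟩ʳ j) <ℤ a (σ ⟨$⟩ʳ i)

signPow : ℕ → ℤ
signPow zero = + 1
signPow (suc k) = - signPow k

inversions : {k : ℕ} → Permutation′ k → ℕ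
inversions {k} σ =
  length (filter (λ p → Data.Product.proj₂ p Fin.<? Data.Product.proj₁ p)
    (concatMap (λ i → concatMap (λ j → if ⌊ i Fin.<? j ⌋ then (σ ⟨$⟩ʳ i , σ ⟨$⟩ʳ j) ∷ [] else []) (allFin k)) (allFin k)))
  where import Data.Product

sign : {k : ℕ} → Permutation′ k → ℤ
sign σ = signPow (inversions σ)

-- Skew shapes and ribbons.  Box (i , j): column i, row j (both ≥ 1);
-- (i , j) ∈ μ iff i ≤ μ_j.

Box : Set
Box = ℕ × ℕ

InSkew : List ℕ → List ℕ → Box → Set
InSkew μ ν (i , j) = 1 ≤ i × 1 ≤ j × part μ j < i × i ≤ part ν j

Contained : List ℕ → List ℕ → Set
Contained μ ν = ∀ j → part μ j ≤ part ν j

skewSize : List ℕ → List ℕ → ℕ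
skewSize μ ν = sum (map (λ j → part ν j ∸ part μ j) (oneTo (length ν)))

Adjacent : Box → Box → Set
Adjacent (i , j) (i' , j') =
  (i' ≡ suc i × j' ≡ j) ⊎ (i ≡ suc i' × j' ≡ j) ⊎
  (j' ≡ suc j × i' ≡ i) ⊎ (j ≡ suc j' × i' ≡ i)

data Path (P : Box → Set) : Box → Box → Set where
  here : ∀ {a} → P a → Path P a a
  step : ∀ {a b c} → P a → Adjacent a b → Path P b c → Path P a c

EdgeConnected : (Box → Set) → Set
EdgeConnected P = ∀ a b → P a → P b → Path P a b

No2x2 : (Box → Set) → Set
No2x2 P = ∀ i j → ¬ (P (i , j) × P (suc i , j) × P (i , suc j) × P (suc i , suc j))

IsRibbon : ℕ → List ℕ → List ℕ → Set
IsRibbon r μ ν =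
  Contained μ ν × skewSize μ ν ≡ r ×
  EdgeConnected (InSkew μ ν) × No2x2 (InSkew μ ν)

ht : List ℕ → List ℕ → ℕ
ht μ ν = length (filter (λ j → part μ j ℕ.<? part ν j) (oneTo (length ν))) ∸ 1

corr : (m n : ℕ) → List ℕ → List ℕ → List ℕ
corr m n δ γ = map (λ j → m + part δ j) (oneTo n) ++ conj γ

CondL : (m n r : ℕ) → List ℕ → ℕ → List ℕ → List ℕ → Set
CondL m n r μ l δ γ =
  IsRearrangement (λ i → + (vec n δ i + ρ n i)) (αρ m n μ l) ×
  IsRearrangement (λ i → + (vec m γ i + ρ m i)) (βρ m n r μ l)

PairL : (m n r : ℕ) → List ℕ → ℕ → List ℕ → List ℕ → Set
PairL m n r μ l δ γ =
  IsPartition δ × IsPartition γ × length δ ≤ n × length γ ≤ m ×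
  l < r × CondL m n r μ l δ γ

InDomain : (m n r : ℕ) → List ℕ → List ℕ → List ℕ → Set
InDomain m n r μ δ γ = ∃ λ l → PairL m n r μ l δ γ

InTarget : (m n r : ℕ) → List ℕ → List ℕ → Set
InTarget m n r μ ν = IsPartition ν × IsRibbon r μ ν × m ≤ part ν n

module Submission where

open import Defs
open import Data.Nat using (ℕ; _≤_; _<_; _∸_)
open import Data.Integer using (ℤ; _*_)
open import Data.List using (List)
open import Data.Product using (Σ; ∃; _×_; _,_)
open import Data.Fin.Permutation using (Permutation′)
open import Relation.Binary.PropositionalEquality using (_≡_)
open import Data.List using (length)
open import Data.Nat using (suc; z≤n; s≤s)

-- Both sides of the correspondence are reduced to explicit descriptions
-- by rows and columns.
--  * Rearrangements.  For a strictly decreasing x + ρ_k, being a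
--    rearrangement of (y_1 - c, …, y_{k-1} - c, v) + ρ_k means that v was
--    inserted at some position a: x_j + c = y_j before a, x_j + c = y_{j-1} + 1
--    after a, and x_a + (k - a) = v (the record Insertion).  The permutation
--    sorting the target is then the cycle moving a to the last place, which
--    has k - a inversions.
--  * Ribbons.  λ ∖ μ is a ribbon exactly when it occupies a range of rows
--    a … b with λ_{j+1} = μ_j + 1 for a ≤ j < b (the record RowRibbon); its
--    size is λ_a - μ_b + (b - a) and its height b - a.

module Permutations where

  open import Data.Nat as ℕ using (zero; suc; _+_; z≤n; s≤s)
  import Data.Nat.Properties as ℕP
  open import Data.Fin as Fin using (Fin; toℕ; fromℕ; inject₁; punchIn; punchOut; fromℕ<)
  import Data.Fin.Properties as FP
  open import Data.Fin.Permutation using (_⟨$⟩ʳ_; _⟨$⟩ˡ_; insert; inverseʳ; inverseˡ; insert-punchIn)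
  import Data.Fin.Permutation as Pm
  open import Data.Integer as ℤ using ()
  import Data.Integer.Properties as ℤP
  open import Data.Sum using (_⊎_; inj₁; inj₂)
  open import Data.Empty using (⊥-elim)
  open import Relation.Nullary using (yes; no)
  open import Relation.Binary using (tri<; tri≈; tri>)
  open import Relation.Binary.PropositionalEquality

  pred<size : ∀ {N} → Fin N → N ∸ 1 ℕ.< N
  pred<size {suc n} _ = ℕP.n<1+n n

  -- A strictly increasing self-map of Fin N is the identity: toℕ (f i) is
  -- bounded below by toℕ i (induction upwards) and above (induction downwards).
  module _ {N : ℕ} (f : Fin N → Fin N) (inc : ∀ i j → i Fin.< j → f i Fin.< f j) where
    private
      lower : ∀ k (i : Fin N) → toℕ i ≡ k → k ℕ.≤ toℕ (f i)
      lower zero i e = z≤n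
      lower (suc k) i e = ℕP.≤-trans (s≤s (lower k j tj)) (inc j i j<i)
        where
          k<N : k ℕ.< N
          k<N = ℕP.<-trans (ℕP.n<1+n k) (subst (ℕ._< N) e (FP.toℕ<n i))
          j = fromℕ< k<N
          tj = FP.toℕ-fromℕ< k<N
          j<i : j Fin.< i
          j<i = subst₂ ℕ._<_ (sym tj) (sym e) (ℕP.n<1+n k)

      upper : ∀ d (i : Fin N) → toℕ i + d ≡ N ∸ 1 → toℕ (f i) + d ℕ.≤ N ∸ 1
      upper zero i e = subst (ℕ._≤ N ∸ 1) (sym (ℕP.+-identityʳ _)) (ℕP.<⇒≤pred (FP.toℕ<n (f i)))
      upper (suc d) i e =
        ℕP.≤-trans (subst (ℕ._≤ toℕ (f j) + d) (sym (ℕP.+-suc (toℕ (f i)) d)) (ℕP.+-monoˡ-≤ d (inc i j i<j)))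
                   (upper d j (trans (cong (_+ d) tj) e′))
        where
          e′ : suc (toℕ i) + d ≡ N ∸ 1
          e′ = trans (sym (ℕP.+-suc (toℕ i) d)) e
          si<N : suc (toℕ i) ℕ.< N
          si<N = ℕP.≤-<-trans (ℕP.≤-trans (ℕP.m≤m+n _ d) (ℕP.≤-reflexive e′)) (pred<size i)
          j = fromℕ< si<N
          tj = FP.toℕ-fromℕ< si<N
          i<j : i Fin.< j
          i<j = subst (toℕ i ℕ.<_) (sym tj) (ℕP.n<1+n _)

    increasing⇒identity : ∀ i → f i ≡ i
    increasing⇒identity i = FP.toℕ-injective (ℕP.≤-antisym up (lower (toℕ i) i refl))
      where
        d = N ∸ 1 ∸ toℕ i
        e : toℕ i + d ≡ N ∸ 1
        e = ℕP.m+[n∸m]≡n (ℕP.<⇒≤pred (FP.toℕ<n i))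
        up : toℕ (f i) ℕ.≤ toℕ i
        up = ℕP.+-cancelʳ-≤ d _ _ (subst (toℕ (f i) + d ℕ.≤_) (sym e) (upper d i e))

  -- If a is strictly decreasing and a ∘ g is strictly decreasing, then g is
  -- strictly increasing.  Used to show that the reindexing maps below are
  -- increasing, hence identities.
  decreasing-reflect : ∀ {M N} (a : Fin M → ℤ) (g : Fin N → Fin M) →
    (∀ i j → i Fin.< j → a j ℤ.< a i) → (∀ i j → i Fin.< j → a (g j) ℤ.< a (g i)) →
    ∀ i j → i Fin.< j → g i Fin.< g j
  decreasing-reflect a g dec-a dec-ag i j i<j with FP.<-cmp (g i) (g j)
  ... | tri< lt _ _ = lt
  ... | tri≈ _ e _ = ⊥-elim (ℤP.<-irrefl (cong a (sym e)) (dec-ag i j i<j))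
  ... | tri> _ _ gt = ⊥-elim (ℤP.<-asym (dec-ag i j i<j) (dec-a _ _ gt))

  punchIn-last : ∀ {N} (t : Fin N) → punchIn (fromℕ N) t ≡ inject₁ t
  punchIn-last Fin.zero = refl
  punchIn-last (Fin.suc t) = cong Fin.suc (punchIn-last t)

  punchIn-mono-< : ∀ {N} (p : Fin (suc N)) (t u : Fin N) → t Fin.< u → punchIn p t Fin.< punchIn p u
  punchIn-mono-< p t u t<u = FP.≤∧≢⇒< (FP.punchIn-mono-≤ p t u (ℕP.<⇒≤ t<u))
    (λ e → FP.<⇒≢ t<u (FP.punchIn-injective p t u e))

  at-or-punchIn : ∀ {N} (p i : Fin (suc N)) → i ≡ p ⊎ Σ (Fin N) λ t → i ≡ punchIn p t
  at-or-punchIn p i with p Fin.≟ i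
  ... | yes e = inj₁ (sym e)
  ... | no ne = inj₂ (punchOut ne , sym (FP.punchIn-punchOut ne))

  -- The cycle sending p to the last position and keeping the order of the
  -- other positions.
  toLast : ∀ {N} → Fin (suc N) → Permutation′ (suc N)
  toLast {N} p = insert p (fromℕ N) Pm.id

  toLast-at : ∀ {N} (p : Fin (suc N)) → toLast p ⟨$⟩ʳ p ≡ fromℕ N
  toLast-at p with p Fin.≟ p
  ... | yes _ = refl
  ... | no ne = ⊥-elim (ne refl)

  toLast-punchIn : ∀ {N} (p : Fin (suc N)) t → toLast p ⟨$⟩ʳ punchIn p t ≡ inject₁ t
  toLast-punchIn {N} p t = trans (insert-punchIn p (fromℕ N) Pm.id t) (punchIn-last t)

  -- A rearrangement D = A ∘ π of a sequence A that is strictly decreasing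
  -- except possibly at its last entry, where D itself is strictly
  -- decreasing: D is A with the last entry moved to some position p, so π
  -- may be replaced by toLast p.
  module _ {N : ℕ} (D A : Fin (suc N) → ℤ) (decD : ∀ i j → i Fin.< j → D j ℤ.< D i) where

    rearrangement-peelLast : (∀ t u → t Fin.< u → A (inject₁ u) ℤ.< A (inject₁ t)) →
      (π : Permutation′ (suc N)) → (∀ i → D i ≡ A (π ⟨$⟩ʳ i)) →
      Σ (Fin (suc N)) λ p → D p ≡ A (fromℕ N) × (∀ t → D (punchIn p t) ≡ A (inject₁ t))
    rearrangement-peelLast decA π eq = p , hp , hT
      where
        p = π ⟨$⟩ˡ fromℕ N
        hp : D p ≡ A (fromℕ N)
        hp = trans (eq p) (cong A (inverseʳ π))
        notLast : ∀ t → fromℕ N ≢ π ⟨$⟩ʳ punchIn p t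
        notLast t e = FP.punchInᵢ≢i p t (trans (sym (inverseˡ π)) (cong (π ⟨$⟩ˡ_) (sym e)))
        -- the position among the first N entries of A that punchIn p t comes from
        ψ : Fin N → Fin N
        ψ t = punchOut (notLast t)
        Dψ : ∀ t → D (punchIn p t) ≡ A (inject₁ (ψ t))
        Dψ t = trans (eq _) (cong A (trans (sym (FP.punchIn-punchOut (notLast t))) (punchIn-last (ψ t))))
        ψ-inc : ∀ t u → t Fin.< u → ψ t Fin.< ψ u
        ψ-inc = decreasing-reflect (λ t → A (inject₁ t)) ψ decA
          (λ t u t<u → subst₂ ℤ._<_ (Dψ u) (Dψ t) (decD _ _ (punchIn-mono-< p t u t<u)))
        hT : ∀ t → D (punchIn p t) ≡ A (inject₁ t)
        hT t = trans (Dψ t) (cong (λ x → A (inject₁ x)) (increasing⇒identity ψ ψ-inc t))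

    toLast-rearranges : (p : Fin (suc N)) → D p ≡ A (fromℕ N) → (∀ t → D (punchIn p t) ≡ A (inject₁ t)) →
      ∀ i → D i ≡ A (toLast p ⟨$⟩ʳ i)
    toLast-rearranges p hp hT i with at-or-punchIn p i
    ... | inj₁ refl = trans hp (cong A (sym (toLast-at p)))
    ... | inj₂ (t , refl) = trans (hT t) (cong A (sym (toLast-punchIn p t)))

  sorting-unique : ∀ {N} (D A : Fin N → ℤ) → (∀ i j → i Fin.< j → D j ℤ.< D i) →
    (π σ : Permutation′ N) → (∀ i → D i ≡ A (π ⟨$⟩ʳ i)) →
    (∀ i j → i Fin.< j → A (σ ⟨$⟩ʳ j) ℤ.< A (σ ⟨$⟩ʳ i)) →
    ∀ i → σ ⟨$⟩ʳ i ≡ π ⟨$⟩ʳ i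
  sorting-unique D A decD π σ eq srt i = trans (cong (σ ⟨$⟩ʳ_) (sym (increasing⇒identity ψ ψ-inc i))) (inverseʳ σ)
    where
      ψ : _ → _
      ψ i = σ ⟨$⟩ˡ (π ⟨$⟩ʳ i)
      Aψ : ∀ i → A (σ ⟨$⟩ʳ ψ i) ≡ D i
      Aψ i = trans (cong A (inverseʳ σ)) (sym (eq i))
      ψ-inc : ∀ i j → i Fin.< j → ψ i Fin.< ψ j
      ψ-inc = decreasing-reflect (λ i → A (σ ⟨$⟩ʳ i)) ψ srt
        (λ i j i<j → subst₂ ℤ._<_ (sym (Aψ j)) (sym (Aψ i)) (decD i j i<j))

module Inversions where

  open Permutations
  open import Data.Nat as ℕ using (zero; suc; _+_; z≤n; s≤s)
  import Data.Nat.Properties as ℕP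
  open import Data.Nat.ListAction using (sum)
  open import Data.Fin as Fin using (Fin; toℕ; fromℕ; inject₁; punchIn)
  import Data.Fin.Properties as FP
  open import Data.Fin.Permutation using (_⟨$⟩ʳ_)
  open import Data.List using ([]; _∷_; length; map; filter; allFin; concatMap; tabulate)
  import Data.List.Properties as LP
  open import Data.Product using (proj₁; proj₂)
  open import Data.Sum using (inj₁; inj₂)
  open import Data.Bool using (if_then_else_)
  open import Data.Empty using (⊥-elim)
  open import Relation.Nullary using (¬_; yes; no; Dec)
  open import Relation.Nullary.Decidable using (⌊_⌋)
  open import Relation.Unary using (Decidable)
  open import Relation.Binary.PropositionalEquality
  open import Function using (_∘_)
  open import Relation.Binary using (tri<; tri≈; tri>)

  length-filter-concatMap : ∀ {A B : Set} {P : B → Set} (P? : Decidable P) (h : A → List B) (xs : List A) →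
    length (filter P? (concatMap h xs)) ≡ sum (map (λ x → length (filter P? (h x))) xs)
  length-filter-concatMap P? h [] = refl
  length-filter-concatMap P? h (x ∷ xs) = trans (cong length (LP.filter-++ P? (h x) (concatMap h xs)))
    (trans (LP.length-++ (filter P? (h x))) (cong (length (filter P? (h x)) +_) (length-filter-concatMap P? h xs)))

  sum-tabulate-zeros : ∀ {k} (F : Fin k → ℕ) → (∀ i → F i ≡ 0) → sum (tabulate F) ≡ 0
  sum-tabulate-zeros {zero} F z = refl
  sum-tabulate-zeros {suc k} F z = cong₂ _+_ (z Fin.zero) (sum-tabulate-zeros (F ∘ Fin.suc) (z ∘ Fin.suc))

  sum-tabulate-single : ∀ {k} (F : Fin k → ℕ) (p : Fin k) → (∀ i → i ≢ p → F i ≡ 0) → sum (tabulate F) ≡ F p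
  sum-tabulate-single {suc k} F Fin.zero z =
    trans (cong (F Fin.zero +_) (sum-tabulate-zeros (F ∘ Fin.suc) (λ i → z (Fin.suc i) (λ ())))) (ℕP.+-identityʳ _)
  sum-tabulate-single {suc k} F (Fin.suc p) z =
    cong₂ _+_ (z Fin.zero (λ ())) (sum-tabulate-single (F ∘ Fin.suc) p (λ i ne → z (Fin.suc i) (λ e → ne (FP.suc-injective e))))

  sum-tabulate-ones : ∀ {k} (F : Fin k → ℕ) → (∀ i → F i ≡ 1) → sum (tabulate F) ≡ k
  sum-tabulate-ones {zero} F o = refl
  sum-tabulate-ones {suc k} F o = cong₂ _+_ (o Fin.zero) (sum-tabulate-ones (F ∘ Fin.suc) (o ∘ Fin.suc))

  sum-tabulate-above : ∀ {N} (G : Fin (suc N) → ℕ) (p : Fin (suc N)) →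
    (∀ j → p Fin.< j → G j ≡ 1) → (∀ j → ¬ p Fin.< j → G j ≡ 0) → sum (tabulate G) ≡ N ∸ toℕ p
  sum-tabulate-above {N} G Fin.zero a b =
    cong₂ _+_ (b Fin.zero (λ ())) (sum-tabulate-ones (G ∘ Fin.suc) (λ j → a (Fin.suc j) (s≤s z≤n)))
  sum-tabulate-above {suc N} G (Fin.suc p) a b =
    cong₂ _+_ (b Fin.zero (λ ()))
      (sum-tabulate-above (G ∘ Fin.suc) p (λ j lt → a (Fin.suc j) (s≤s lt)) (λ j nlt → b (Fin.suc j) (λ lt → nlt (ℕP.≤-pred lt))))

  -- The inversion count of Defs, for an arbitrary self-map of Fin k.
  inversionsOf : ∀ {k} → (Fin k → Fin k) → ℕ
  inversionsOf {k} f =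
    length (filter (λ p → proj₂ p Fin.<? proj₁ p)
      (concatMap (λ i → concatMap (λ j → if ⌊ i Fin.<? j ⌋ then (f i , f j) ∷ [] else []) (allFin k)) (allFin k)))

  inversionCell : ∀ {k} → (Fin k → Fin k) → Fin k → Fin k → ℕ
  inversionCell f i j = length (filter (λ p → proj₂ p Fin.<? proj₁ p) (if ⌊ i Fin.<? j ⌋ then (f i , f j) ∷ [] else []))

  inversionsOf-sum : ∀ {k} (f : Fin k → Fin k) →
    inversionsOf f ≡ sum (tabulate (λ i → sum (tabulate (λ j → inversionCell f i j))))
  inversionsOf-sum {k} f = trans (length-filter-concatMap P? row (allFin k))
    (trans (cong sum (LP.map-tabulate (λ i → i) (λ i → length (filter P? (row i)))))
    (cong sum (LP.tabulate-cong (λ i → trans (length-filter-concatMap P? (g i) (allFin k))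
                                         (cong sum (LP.map-tabulate (λ j → j) (λ j → length (filter P? (g i j)))))))))
    where
      P? = λ (p : Fin k × Fin k) → proj₂ p Fin.<? proj₁ p
      g = λ (i j : Fin k) → if ⌊ i Fin.<? j ⌋ then (f i , f j) ∷ [] else []
      row = λ (i : Fin k) → concatMap (g i) (allFin k)

  inversionsOf-cong : ∀ {k} (f g : Fin k → Fin k) → (∀ i → f i ≡ g i) → inversionsOf f ≡ inversionsOf g
  inversionsOf-cong f g e =
    trans (inversionsOf-sum f) (trans (cong sum (LP.tabulate-cong (λ i → cong sum (LP.tabulate-cong (λ j → cell≡ i j)))))
                                      (sym (inversionsOf-sum g)))
    where cell≡ : ∀ i j → inversionCell f i j ≡ inversionCell g i j
          cell≡ i j rewrite e i | e j = refl

  inversionCell-inverted : ∀ {k} (f : Fin k → Fin k) i j → i Fin.< j → f j Fin.< f i → inversionCell f i j ≡ 1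
  inversionCell-inverted f i j lt lt' with i Fin.<? j
  ... | no n = ⊥-elim (n lt)
  ... | yes _ = cong length (LP.filter-accept (λ p → proj₂ p Fin.<? proj₁ p) {x = (f i , f j)} {xs = []} lt')

  inversionCell-unordered : ∀ {k} (f : Fin k → Fin k) i j → ¬ i Fin.< j → inversionCell f i j ≡ 0
  inversionCell-unordered f i j n with i Fin.<? j
  ... | yes lt = ⊥-elim (n lt)
  ... | no _ = refl

  inversionCell-ordered : ∀ {k} (f : Fin k → Fin k) i j → ¬ f j Fin.< f i → inversionCell f i j ≡ 0
  inversionCell-ordered f i j n with i Fin.<? j
  ... | no _ = refl
  ... | yes _ = cong length (LP.filter-reject (λ p → proj₂ p Fin.<? proj₁ p) {x = (f i , f j)} {xs = []} n)

  punchIn-reflect-< : ∀ {N} (p : Fin (suc N)) (t u : Fin N) → punchIn p t Fin.< punchIn p u → t Fin.< u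
  punchIn-reflect-< p t u lt with FP.<-cmp t u
  ... | tri< a _ _ = a
  ... | tri≈ _ refl _ = ⊥-elim (ℕP.<-irrefl refl lt)
  ... | tri> _ _ c = ⊥-elim (ℕP.<-asym lt (punchIn-mono-< p u t c))

  -- The cycle toLast p has exactly N - p inversions: the pairs (p , j) with
  -- p < j; the other entries keep their relative order.
  inversions-toLast : ∀ {N} (p : Fin (suc N)) → inversions (toLast p) ≡ N ∸ toℕ p
  inversions-toLast {N} p =
    trans (inversionsOf-sum R) (trans (sum-tabulate-single _ p rowZero) (sum-tabulate-above _ p above notAbove))
    where
      R = toLast p ⟨$⟩ʳ_
      inject₁<last : ∀ t → inject₁ t Fin.< fromℕ N
      inject₁<last t = subst₂ ℕ._<_ (sym (FP.toℕ-inject₁ t)) (sym (FP.toℕ-fromℕ N)) (FP.toℕ<n t)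
      rowZero : ∀ i → i ≢ p → sum (tabulate (λ j → inversionCell R i j)) ≡ 0
      rowZero i ne with at-or-punchIn p i
      ... | inj₁ e = ⊥-elim (ne e)
      ... | inj₂ (t , refl) = sum-tabulate-zeros _ cellZero
        where
          cellZero : ∀ j → inversionCell R (punchIn p t) j ≡ 0
          cellZero j with at-or-punchIn p j
          ... | inj₁ refl = inversionCell-ordered R _ _
                (λ lt → ℕP.<-asym (inject₁<last t) (subst₂ Fin._<_ (toLast-at p) (toLast-punchIn p t) lt))
          ... | inj₂ (u , refl) = byOrder (punchIn p t Fin.<? punchIn p u)
            where
            byOrder : Dec (punchIn p t Fin.< punchIn p u) → inversionCell R (punchIn p t) (punchIn p u) ≡ 0
            byOrder (no n) = inversionCell-unordered R _ _ n
            byOrder (yes lt) = inversionCell-ordered R _ _ (λ lt' → ℕP.<-asym (punchIn-reflect-< p t u lt)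
                  (subst₂ ℕ._<_ (FP.toℕ-inject₁ u) (FP.toℕ-inject₁ t) (subst₂ Fin._<_ (toLast-punchIn p u) (toLast-punchIn p t) lt')))
      above : ∀ j → p Fin.< j → inversionCell R p j ≡ 1
      above j lt with at-or-punchIn p j
      ... | inj₁ refl = ⊥-elim (ℕP.<-irrefl refl lt)
      ... | inj₂ (u , refl) = inversionCell-inverted R _ _ lt (subst₂ Fin._<_ (sym (toLast-punchIn p u)) (sym (toLast-at p)) (inject₁<last u))
      notAbove : ∀ j → ¬ p Fin.< j → inversionCell R p j ≡ 0
      notAbove j n = inversionCell-unordered R p j n

module Insertions where

  open Permutations
  open Inversions
  open import Data.Nat as ℕ using (zero; suc; _+_; z≤n; s≤s)
  import Data.Nat.Properties as ℕP
  open import Data.Integer as ℤ using (+_; -_) renaming (_+_ to _+ℤ_; _-_ to _-ℤ_; _<_ to _<ℤ_)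
  import Data.Integer.Properties as ℤP
  open import Data.Integer.Tactic.RingSolver using (solve-∀)
  open import Data.Fin as Fin using (Fin; toℕ; fromℕ; inject₁; punchIn; fromℕ<)
  import Data.Fin.Properties as FP
  open import Data.Fin.Permutation using (_⟨$⟩ʳ_)
  open import Data.Product using (proj₁; proj₂)
  open import Data.Sum using ([_,_]′)
  open import Data.Bool using (if_then_else_)
  open import Data.Empty using (⊥-elim)
  open import Relation.Nullary using (yes; no)
  open import Relation.Nullary.Decidable using (⌊_⌋)
  open import Relation.Binary.PropositionalEquality

  shifted : ℕ → ℕ → ℕ → ℤ
  shifted y c w = (+ y -ℤ + c) +ℤ + w

  shifted≡⇒ : ∀ x y c w → + (x + w) ≡ shifted y c w → x + c ≡ y
  shifted≡⇒ x y c w e = ℕP.+-cancelʳ-≡ w _ _ (ℤP.+-injective (begin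
      + (x + c + w)              ≡⟨ cong +_ (ℕP.+-comm (x + c) w) ⟩
      + (w + (x + c))            ≡⟨ cong +_ (sym (ℕP.+-assoc w x c)) ⟩
      + ((w + x) + c)            ≡⟨ cong (λ z → + (z + c)) (ℕP.+-comm w x) ⟩
      + (x + w + c)              ≡⟨ ℤP.pos-+ (x + w) c ⟩
      + (x + w) +ℤ + c           ≡⟨ cong (_+ℤ + c) e ⟩
      shifted y c w +ℤ + c       ≡⟨ cancel (+ y) (+ c) (+ w) ⟩
      + y +ℤ + w                 ≡⟨ sym (ℤP.pos-+ y w) ⟩
      + (y + w)                  ∎))
    where
      open ≡-Reasoning
      cancel : ∀ (y c w : ℤ) → ((y -ℤ c) +ℤ w) +ℤ c ≡ y +ℤ w
      cancel = solve-∀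

  shifted≡⇐ : ∀ x y c w → x + c ≡ y → + (x + w) ≡ shifted y c w
  shifted≡⇐ x y c w refl = begin
      + (x + w)                        ≡⟨ ℤP.pos-+ x w ⟩
      + x +ℤ + w                       ≡⟨ sym (cancel (+ x) (+ c) (+ w)) ⟩
      ((+ x +ℤ + c) -ℤ + c) +ℤ + w     ≡⟨ cong (λ z → (z -ℤ + c) +ℤ + w) (sym (ℤP.pos-+ x c)) ⟩
      shifted (x + c) c w              ∎
    where
      open ≡-Reasoning
      cancel : ∀ (a c w : ℤ) → ((a +ℤ c) -ℤ c) +ℤ w ≡ a +ℤ w
      cancel = solve-∀

  shifted-slide : ∀ y c w → shifted y c (suc w) ≡ shifted (suc y) c w
  shifted-slide y c w = slide (+ y) (+ c) (+ w)
    where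
      slide : ∀ (y c w : ℤ) → (y -ℤ c) +ℤ (+ 1 +ℤ w) ≡ ((+ 1 +ℤ y) -ℤ c) +ℤ w
      slide = solve-∀

  shifted-< : ∀ y y' c w w' → y' ℕ.≤ y → w' ℕ.< w → shifted y' c w' <ℤ shifted y c w
  shifted-< y y' c w w' le lt = ℤP.+-mono-≤-< (ℤP.+-monoˡ-≤ (- + c) (ℤ.+≤+ le)) (ℤ.+<+ lt)

  -- (y_1 - c, …, y_{k-1} - c, v) + ρ_k as a function of the 1-based index j;
  -- at j = suc (toℕ i) this is literally αρ / βρ of Defs.
  lastReplaced : ℕ → (ℕ → ℕ) → ℕ → ℕ → ℕ → ℤ
  lastReplaced k y c v j = (if ⌊ j ℕ.≟ k ⌋ then + v else (+ y j -ℤ + c)) +ℤ + (k ∸ j)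

  plusStaircase : ℕ → (ℕ → ℕ) → ℕ → ℤ
  plusStaircase k x j = + (x j + (k ∸ j))

  lastReplaced-last : ∀ k y c v → lastReplaced k y c v k ≡ + v
  lastReplaced-last k y c v with k ℕ.≟ k
  ... | no k≢k = ⊥-elim (k≢k refl)
  ... | yes _ rewrite ℕP.n∸n≡0 k = ℤP.+-identityʳ (+ v)

  lastReplaced-mid : ∀ k y c v j → j ≢ k → lastReplaced k y c v j ≡ shifted (y j) c (k ∸ j)
  lastReplaced-mid k y c v j j≢k with j ℕ.≟ k
  ... | yes j≡k = ⊥-elim (j≢k j≡k)
  ... | no _ = refl

  Antitone : (ℕ → ℕ) → Set
  Antitone x = ∀ i j → i ℕ.≤ j → x (suc j) ℕ.≤ x (suc i)

  -- x + ρ_k is (y_1 - c, …, y_{k-1} - c, v) + ρ_k with v moved to position a.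
  record Insertion (k : ℕ) (x y : ℕ → ℕ) (c v : ℕ) : Set where
    field
      a : ℕ
      1≤a : 1 ≤ a
      a≤k : a ≤ k
      before : ∀ j → 1 ≤ j → j < a → x j + c ≡ y j
      after : ∀ j → a < j → j ≤ k → x j + c ≡ suc (y (j ∸ 1))
      at : x a + (k ∸ a) ≡ v

  toℕ-punchIn< : ∀ {N} (p : Fin (suc N)) (t : Fin N) → toℕ t < toℕ p → toℕ (punchIn p t) ≡ toℕ t
  toℕ-punchIn< (Fin.suc p) Fin.zero lt = refl
  toℕ-punchIn< (Fin.suc p) (Fin.suc t) (s≤s lt) = cong suc (toℕ-punchIn< p t lt)

  toℕ-punchIn≥ : ∀ {N} (p : Fin (suc N)) (t : Fin N) → toℕ p ≤ toℕ t → toℕ (punchIn p t) ≡ suc (toℕ t)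
  toℕ-punchIn≥ Fin.zero t le = refl
  toℕ-punchIn≥ (Fin.suc p) (Fin.suc t) (s≤s le) = cong suc (toℕ-punchIn≥ p t le)

  module Staircase (N : ℕ) (x y : ℕ → ℕ) (c v : ℕ) (x-anti : Antitone x) (y-anti : Antitone y) where
    k : ℕ
    k = suc N

    D : Fin k → ℤ
    D i = plusStaircase k x (suc (toℕ i))

    A : Fin k → ℤ
    A i = lastReplaced k y c v (suc (toℕ i))

    D-decreasing : ∀ i j → i Fin.< j → D j <ℤ D i
    D-decreasing i j lt = ℤ.+<+ (ℕP.+-mono-≤-< (x-anti _ _ (ℕP.<⇒≤ lt)) (ℕP.∸-monoʳ-< (s≤s lt) (FP.toℕ<n j)))

    A-inject₁ : ∀ (t : Fin N) → A (inject₁ t) ≡ shifted (y (suc (toℕ t))) c (k ∸ suc (toℕ t))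
    A-inject₁ t = trans (cong (λ z → lastReplaced k y c v (suc z)) (FP.toℕ-inject₁ t))
      (lastReplaced-mid k y c v (suc (toℕ t)) (λ e → ℕP.<-irrefl (ℕP.suc-injective e) (FP.toℕ<n t)))

    A-decreasing : ∀ t u → t Fin.< u → A (inject₁ u) <ℤ A (inject₁ t)
    A-decreasing t u lt = subst₂ _<ℤ_ (sym (A-inject₁ u)) (sym (A-inject₁ t))
      (shifted-< _ _ c _ _ (y-anti _ _ (ℕP.<⇒≤ lt)) (ℕP.∸-monoʳ-< (s≤s lt) (ℕP.<⇒≤ (s≤s (FP.toℕ<n u)))))

    A-last : A (fromℕ N) ≡ + v
    A-last = trans (cong (λ z → lastReplaced k y c v (suc z)) (FP.toℕ-fromℕ N)) (lastReplaced-last k y c v)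

    D-before : ∀ (p : Fin k) (t : Fin N) → toℕ t < toℕ p → D (punchIn p t) ≡ + (x (suc (toℕ t)) + (k ∸ suc (toℕ t)))
    D-before p t lt = cong (λ z → plusStaircase k x (suc z)) (toℕ-punchIn< p t lt)

    D-after : ∀ (p : Fin k) (t : Fin N) → toℕ p ≤ toℕ t → D (punchIn p t) ≡ + (x (suc (suc (toℕ t))) + (k ∸ suc (suc (toℕ t))))
    D-after p t le = cong (λ z → plusStaircase k x (suc z)) (toℕ-punchIn≥ p t le)

    A-slide : ∀ (t : Fin N) → A (inject₁ t) ≡ shifted (suc (y (suc (toℕ t)))) c (k ∸ suc (suc (toℕ t)))
    A-slide t = trans (A-inject₁ t) (trans (cong (shifted (y (suc (toℕ t))) c) (ℕP.+-∸-assoc 1 (FP.toℕ<n t)))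
                                           (shifted-slide (y (suc (toℕ t))) c (N ∸ suc (toℕ t))))

    insertion-of-rearrangement : (π : Permutation′ k) → (∀ i → D i ≡ A (π ⟨$⟩ʳ i)) → Insertion k x y c v
    insertion-of-rearrangement π eq = record
      { a = suc (toℕ p) ; 1≤a = s≤s z≤n ; a≤k = s≤s (ℕP.<⇒≤pred (FP.toℕ<n p))
      ; before = before ; after = after ; at = ℤP.+-injective (trans hp A-last) }
      where
        peeled = rearrangement-peelLast D A D-decreasing A-decreasing π eq
        p = proj₁ peeled
        hp = proj₁ (proj₂ peeled)
        hT = proj₂ (proj₂ peeled)
        before : ∀ j → 1 ≤ j → j < suc (toℕ p) → x j + c ≡ y j
        before (suc j) _ (s≤s lt) = subst (λ z → x (suc z) + c ≡ y (suc z)) tt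
            (shifted≡⇒ _ _ c _ (trans (sym (D-before p t (subst (_< toℕ p) (sym tt) lt))) (trans (hT t) (A-inject₁ t))))
          where
            j<N = ℕP.<-≤-trans lt (ℕP.<⇒≤pred (FP.toℕ<n p))
            t = fromℕ< j<N
            tt = FP.toℕ-fromℕ< j<N
        after : ∀ j → suc (toℕ p) < j → j ≤ k → x j + c ≡ suc (y (j ∸ 1))
        after (suc (suc j)) (s≤s le) (s≤s j<N) = subst (λ z → x (suc (suc z)) + c ≡ suc (y (suc z))) tt
            (shifted≡⇒ _ _ c _ (trans (sym (D-after p t (subst (toℕ p ≤_) (sym tt) (ℕP.≤-pred le)))) (trans (hT t) (A-slide t))))
          where
            t = fromℕ< j<N
            tt = FP.toℕ-fromℕ< j<N

    module FromInsertion (s : Insertion k x y c v) where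
      open Insertion s
      a<suc-k : a ∸ 1 < k
      a<suc-k = subst (_≤ k) (sym (ℕP.m+[n∸m]≡n 1≤a)) a≤k
      p : Fin k
      p = fromℕ< a<suc-k
      suc-p : suc (toℕ p) ≡ a
      suc-p = trans (cong suc (FP.toℕ-fromℕ< a<suc-k)) (ℕP.m+[n∸m]≡n 1≤a)

      hp : D p ≡ A (fromℕ N)
      hp = trans (cong (plusStaircase k x) suc-p) (trans (cong +_ at) (sym A-last))

      hT-before : ∀ t → toℕ t < toℕ p → D (punchIn p t) ≡ A (inject₁ t)
      hT-before t lt = trans (D-before p t lt) (trans (shifted≡⇐ _ _ c _ x+c≡y) (sym (A-inject₁ t)))
        where x+c≡y = before (suc (toℕ t)) (s≤s z≤n) (subst (suc (suc (toℕ t)) ≤_) suc-p (s≤s lt))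

      hT-after : ∀ t → toℕ p ≤ toℕ t → D (punchIn p t) ≡ A (inject₁ t)
      hT-after t le = trans (D-after p t le) (trans (shifted≡⇐ _ _ c _ x+c≡y) (sym (A-slide t)))
        where x+c≡y = after (suc (suc (toℕ t))) (subst (_< suc (suc (toℕ t))) suc-p (s≤s (s≤s le))) (s≤s (FP.toℕ<n t))

      hT : ∀ t → D (punchIn p t) ≡ A (inject₁ t)
      hT t = [ hT-before t , hT-after t ]′ (ℕP.<-≤-connex (toℕ t) (toℕ p))

      rearrangement-of-insertion : IsRearrangement D A
      rearrangement-of-insertion = toLast p , toLast-rearranges D A D-decreasing p hp hT

      -- a permutation sorting A agrees with toLast p, so it has k - a inversions
      inversions-of-sorting : (σ : Permutation′ k) → Sorts A σ → inversions σ ≡ k ∸ a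
      inversions-of-sorting σ srt = begin
        inversions σ             ≡⟨ inversionsOf-cong (σ ⟨$⟩ʳ_) (toLast p ⟨$⟩ʳ_) σ≗toLast ⟩
        inversions (toLast p)    ≡⟨ inversions-toLast p ⟩
        N ∸ toℕ p                ≡⟨ cong (k ∸_) suc-p ⟩
        k ∸ a                    ∎
        where
          open ≡-Reasoning
          σ≗toLast = sorting-unique D A D-decreasing (toLast p) σ (toLast-rearranges D A D-decreasing p hp hT) srt

module Partitions where

  open Insertions using (Antitone)
  open import Data.Nat as ℕ using (zero; suc; z≤n; s≤s)
  import Data.Nat.Properties as ℕP
  open import Data.List using ([]; _∷_; length)
  open import Data.List.Relation.Unary.All using ([]; _∷_)
  open import Data.List.Relation.Unary.Linked using (Linked; []; [-]; _∷_)
  open import Data.Product using (proj₁; proj₂)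
  open import Data.Empty using (⊥-elim)
  open import Relation.Binary.PropositionalEquality

  tailP : ∀ {x xs} → IsPartition (x ∷ xs) → IsPartition xs
  tailP ([-] , _ ∷ a) = [] , a
  tailP (_ ∷ l , _ ∷ a) = l , a

  part-tail≤head : ∀ {x xs} → IsPartition (x ∷ xs) → ∀ j → part xs j ≤ x
  part-tail≤head {x} {[]} P zero = z≤n
  part-tail≤head {x} {[]} P (suc j) = z≤n
  part-tail≤head {x} {y ∷ ys} P zero = z≤n
  part-tail≤head {x} {y ∷ ys} (yx ∷ _ , _) (suc zero) = yx
  part-tail≤head {x} {y ∷ ys} P@(yx ∷ _ , _) (suc (suc j)) = ℕP.≤-trans (part-tail≤head (tailP P) (suc j)) yx

  part-≤head : ∀ {x xs} → IsPartition (x ∷ xs) → ∀ i → 1 ≤ i → part (x ∷ xs) i ≤ x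
  part-≤head P (suc zero) _ = ℕP.≤-refl
  part-≤head P (suc (suc i)) _ = part-tail≤head P (suc i)

  part-antitone′ : ∀ {xs} → IsPartition xs → Antitone (part xs)
  part-antitone′ {[]} P i j le = z≤n
  part-antitone′ {x ∷ xs} P zero zero le = ℕP.≤-refl
  part-antitone′ {x ∷ xs} P zero (suc j) le = part-tail≤head P (suc j)
  part-antitone′ {x ∷ xs} P (suc i) (suc j) (s≤s le) = part-antitone′ (tailP P) i j le

  part-antitone : ∀ {xs} → IsPartition xs → ∀ i j → 1 ≤ i → i ≤ j → part xs j ≤ part xs i
  part-antitone P (suc i) (suc j) _ (s≤s le) = part-antitone′ P i j le

  partZero : ∀ xs j → length xs < j → part xs j ≡ 0
  partZero [] zero _ = refl
  partZero [] (suc j) _ = refl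
  partZero (x ∷ xs) (suc (suc j)) (s≤s lt) = partZero xs (suc j) lt

  partExt : ∀ {xs ys} → IsPartition xs → IsPartition ys → (∀ j → 1 ≤ j → part xs j ≡ part ys j) → xs ≡ ys
  partExt {[]} {[]} _ _ e = refl
  partExt {[]} {y ∷ ys} _ (_ , py ∷ _) e = ⊥-elim (ℕP.<-irrefl (e 1 (s≤s z≤n)) py)
  partExt {x ∷ xs} {[]} (_ , px ∷ _) _ e = ⊥-elim (ℕP.<-irrefl (sym (e 1 (s≤s z≤n))) px)
  partExt {x ∷ xs} {y ∷ ys} P Q e = cong₂ _∷_ (e 1 (s≤s z≤n)) (partExt (tailP P) (tailP Q) e')
    where e' : ∀ j → 1 ≤ j → part xs j ≡ part ys j
          e' (suc j) _ = e (suc (suc j)) (s≤s z≤n)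

  -- Comparing numbers through their positive lower bounds: the way the
  -- statements "i ≤ λ_j ⟺ j ≤ λ'_i" are turned into equations of parts.
  ≤-by-elements : ∀ x y → (∀ i → 1 ≤ i → i ≤ x → i ≤ y) → x ≤ y
  ≤-by-elements zero y f = z≤n
  ≤-by-elements (suc x) y f = f (suc x) (s≤s z≤n) ℕP.≤-refl

  ≡-by-elements : ∀ x y → (∀ i → 1 ≤ i → i ≤ x → i ≤ y) → (∀ i → 1 ≤ i → i ≤ y → i ≤ x) → x ≡ y
  ≡-by-elements x y f g = ℕP.≤-antisym (≤-by-elements x y f) (≤-by-elements y x g)

  fromParts : (ℕ → ℕ) → ℕ → List ℕ
  fromParts f zero = []
  fromParts f (suc N) with f 1
  ... | zero = []
  ... | suc v = suc v ∷ fromParts (λ j → f (suc j)) N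

  fromParts-length : ∀ f N → length (fromParts f N) ≤ N
  fromParts-length f zero = z≤n
  fromParts-length f (suc N) with f 1
  ... | zero = z≤n
  ... | suc v = s≤s (fromParts-length _ N)

  fromParts-part : ∀ f N → Antitone f → ∀ j → 1 ≤ j → j ≤ N → part (fromParts f N) j ≡ f j
  fromParts-part f zero d (suc j) _ ()
  fromParts-part f (suc N) d j 1≤j j≤N with f 1 in e
  fromParts-part f (suc N) d (suc j) 1≤j j≤N | zero = sym (ℕP.n≤0⇒n≡0 (subst (f (suc j) ≤_) e (d zero j z≤n)))
  fromParts-part f (suc N) d (suc zero) _ _ | suc v = sym e
  fromParts-part f (suc N) d (suc (suc j)) _ (s≤s j≤N) | suc v =
    fromParts-part (λ j → f (suc j)) N (λ i j le → d (suc i) (suc j) (s≤s le)) (suc j) (s≤s z≤n) j≤N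

  fromParts-beyond : ∀ f N j → N < j → part (fromParts f N) j ≡ 0
  fromParts-beyond f N j lt = partZero (fromParts f N) j (ℕP.≤-<-trans (fromParts-length f N) lt)

  fromParts-isPartition : ∀ f N → Antitone f → IsPartition (fromParts f N)
  fromParts-isPartition f zero d = [] , []
  fromParts-isPartition f (suc N) d with f 1 in e
  ... | zero = [] , []
  ... | suc v = linked , (s≤s z≤n ∷ proj₂ rest)
    where
      g = λ j → f (suc j)
      g-anti : Antitone g
      g-anti i j le = d (suc i) (suc j) (s≤s le)
      rest = fromParts-isPartition g N g-anti
      linked : Linked (λ a b → b ≤ a) (suc v ∷ fromParts g N)
      linked with fromParts g N in e2
      ... | [] = [-]
      ... | w ∷ ws = w≤v ∷ subst (Linked _) e2 (proj₁ rest)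
        where
          nonEmpty : ∀ N → fromParts g N ≡ w ∷ ws → 1 ≤ N
          nonEmpty (suc N) _ = s≤s z≤n
          w≤v : w ≤ suc v
          w≤v = subst₂ _≤_ (trans (sym (fromParts-part g N g-anti 1 (s≤s z≤n) (nonEmpty N e2))) (cong (λ z → part z 1) e2)) e (d 0 1 z≤n)

module Conjugates where

  open Partitions
  open import Data.Nat as ℕ using (zero; suc; z≤n; s≤s)
  import Data.Nat.Properties as ℕP
  open import Data.List using ([]; _∷_; length; map; filter; applyUpTo)
  import Data.List.Properties as LP
  open import Data.List.Relation.Unary.All using ([]; _∷_)
  open import Data.List.Relation.Unary.Linked using ([]; [-]; _∷_)
  open import Data.Product using (proj₁; proj₂)
  open import Data.Empty using (⊥-elim)
  open import Relation.Nullary using (yes; no; Dec)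
  open import Relation.Binary.PropositionalEquality

  oneTo≡ : ∀ (f : ℕ → ℕ) K → map f (oneTo K) ≡ applyUpTo (λ j → f (suc j)) K
  oneTo≡ f K = trans (cong (map f) (LP.map-applyUpTo (λ x → x) suc K)) (LP.map-applyUpTo suc f K)

  part-applyUpTo : ∀ (g : ℕ → ℕ) K j → j < K → part (applyUpTo g K) (suc j) ≡ g j
  part-applyUpTo g (suc K) zero _ = refl
  part-applyUpTo g (suc K) (suc j) (s≤s lt) = part-applyUpTo (λ x → g (suc x)) K j lt

  part-mapOneTo : ∀ (f : ℕ → ℕ) K j → 1 ≤ j → j ≤ K → part (map f (oneTo K)) j ≡ f j
  part-mapOneTo f K (suc j) _ le = trans (cong (λ z → part z (suc j)) (oneTo≡ f K)) (part-applyUpTo (λ j → f (suc j)) K j le)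

  length-mapOneTo : ∀ (f : ℕ → ℕ) K → length (map f (oneTo K)) ≡ K
  length-mapOneTo f K = trans (cong length (oneTo≡ f K)) (LP.length-applyUpTo _ K)

  isPartition-applyUpTo : ∀ (g : ℕ → ℕ) K → (∀ j → j < K → 1 ≤ g j) → (∀ j → suc j < K → g (suc j) ≤ g j) →
    IsPartition (applyUpTo g K)
  isPartition-applyUpTo g zero pos dec = [] , []
  isPartition-applyUpTo g (suc zero) pos dec = [-] , (pos 0 (s≤s z≤n) ∷ [])
  isPartition-applyUpTo g (suc (suc K)) pos dec
    with isPartition-applyUpTo (λ x → g (suc x)) (suc K) (λ j lt → pos (suc j) (s≤s lt)) (λ j lt → dec (suc j) (s≤s lt))
  ... | (l , a) = dec 0 (s≤s (s≤s z≤n)) ∷ l , pos 0 (s≤s z≤n) ∷ a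

  count≥ : ℕ → List ℕ → ℕ
  count≥ j xs = length (filter (λ x → j ℕ.≤? x) xs)

  count≥-spec : ∀ {μ} → IsPartition μ → ∀ i j → 1 ≤ i → 1 ≤ j →
    (i ≤ count≥ j μ → j ≤ part μ i) × (j ≤ part μ i → i ≤ count≥ j μ)
  count≥-spec {[]} P (suc i) j _ 1≤j = (λ ()) , (λ le → ⊥-elim (ℕP.<-irrefl refl (ℕP.<-≤-trans 1≤j le)))
  count≥-spec {x ∷ xs} P i j 1≤i 1≤j = byHead (j ℕ.≤? x)
    where
      Spec : ℕ → Set
      Spec c = (i ≤ c → j ≤ part (x ∷ xs) i) × (j ≤ part (x ∷ xs) i → i ≤ c)
      counted : j ≤ x → ∀ i → 1 ≤ i →
        (i ≤ suc (count≥ j xs) → j ≤ part (x ∷ xs) i) × (j ≤ part (x ∷ xs) i → i ≤ suc (count≥ j xs))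
      counted jx (suc zero) _ = (λ _ → jx) , (λ _ → s≤s z≤n)
      counted jx (suc (suc i)) _ = (λ { (s≤s le) → proj₁ (count≥-spec (tailP P) (suc i) j (s≤s z≤n) 1≤j) le })
                                 , (λ le → s≤s (proj₂ (count≥-spec (tailP P) (suc i) j (s≤s z≤n) 1≤j) le))
      byHead : Dec (j ≤ x) → Spec (count≥ j (x ∷ xs))
      byHead (yes jx) = subst Spec (sym (cong length (LP.filter-accept (λ x → j ℕ.≤? x) jx))) (counted jx i 1≤i)
      byHead (no njx) =
          (λ le → ⊥-elim (njx (ℕP.≤-trans (proj₁ (count≥-spec (tailP P) i j 1≤i 1≤j) (subst (i ≤_) skip le)) (part-tail≤head P i))))
        , (λ le → ⊥-elim (njx (ℕP.≤-trans le (part-≤head P i 1≤i))))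
        where
          skip : count≥ j (x ∷ xs) ≡ count≥ j xs
          skip = cong length (LP.filter-reject (λ x → j ℕ.≤? x) njx)

  conj-length : ∀ μ → length (conj μ) ≡ part μ 1
  conj-length μ = length-mapOneTo (λ j → count≥ j μ) (part μ 1)

  conj-part-in : ∀ μ j → 1 ≤ j → j ≤ part μ 1 → part (conj μ) j ≡ count≥ j μ
  conj-part-in μ j 1≤j le = part-mapOneTo (λ j → count≥ j μ) (part μ 1) j 1≤j le

  conj-part-out : ∀ μ j → part μ 1 < j → part (conj μ) j ≡ 0
  conj-part-out μ j lt = partZero (conj μ) j (subst (_< j) (sym (conj-length μ)) lt)

  conj-spec : ∀ {μ} → IsPartition μ → ∀ i j → 1 ≤ i → 1 ≤ j →
    (i ≤ part (conj μ) j → j ≤ part μ i) × (j ≤ part μ i → i ≤ part (conj μ) j)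
  conj-spec {μ} P i j 1≤i 1≤j with j ℕ.≤? part μ 1
  ... | yes le rewrite conj-part-in μ j 1≤j le = count≥-spec P i j 1≤i 1≤j
  ... | no nle rewrite conj-part-out μ j (ℕP.≰⇒> nle) =
          (λ le → ⊥-elim (ℕP.<-irrefl refl (ℕP.<-≤-trans 1≤i le)))
        , (λ le → ⊥-elim (nle (ℕP.≤-trans le (part-antitone P 1 i (s≤s z≤n) 1≤i))))

  conj-isPartition : ∀ {μ} → IsPartition μ → IsPartition (conj μ)
  conj-isPartition {μ} P = subst IsPartition (sym (oneTo≡ (λ j → count≥ j μ) (part μ 1)))
    (isPartition-applyUpTo (λ j → count≥ (suc j) μ) (part μ 1)
      (λ j lt → proj₂ (count≥-spec P 1 (suc j) (s≤s z≤n) (s≤s z≤n)) lt)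
      (λ j lt → ≤-by-elements _ _ (λ i 1≤i le → proj₂ (count≥-spec P i (suc j) 1≤i (s≤s z≤n))
          (ℕP.≤-trans (ℕP.n≤1+n _) (proj₁ (count≥-spec P i (suc (suc j)) 1≤i (s≤s z≤n)) le)))))

  conj-part≤ : ∀ {γ m} → IsPartition γ → length γ ≤ m → ∀ s → part (conj γ) s ≤ m
  conj-part≤ P len zero = z≤n
  conj-part≤ {γ} {m} P len (suc s) = ℕP.≮⇒≥ λ lt →
    ℕP.n≮0 (subst (suc s ≤_) (partZero γ (suc m) (s≤s len)) (proj₁ (conj-spec P (suc m) (suc s) (s≤s z≤n) (s≤s z≤n)) lt))

module CorrMap where

  open Partitions
  open Conjugates
  open import Data.Nat as ℕ using (zero; suc; _+_; z≤n; s≤s)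
  import Data.Nat.Properties as ℕP
  open import Data.List using ([]; _∷_; length; map; _++_)
  import Data.List.Properties as LP
  open import Data.List.Relation.Unary.All using ([]; _∷_)
  open import Data.List.Relation.Unary.Linked using ([]; [-]; _∷_)
  open import Data.Product using (proj₁; proj₂)
  open import Data.Sum using (_⊎_; inj₁; inj₂)
  open import Relation.Nullary using (yes; no)
  open import Relation.Binary.PropositionalEquality

  isPartition-fromParts : ∀ xs → (∀ j → 1 ≤ j → j ≤ length xs → 1 ≤ part xs j) →
    (∀ j → 1 ≤ j → j < length xs → part xs (suc j) ≤ part xs j) → IsPartition xs
  isPartition-fromParts [] pos dec = [] , []
  isPartition-fromParts (x ∷ []) pos dec = [-] , (pos 1 (s≤s z≤n) (s≤s z≤n) ∷ [])
  isPartition-fromParts (x ∷ y ∷ xs) pos dec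
    with isPartition-fromParts (y ∷ xs) (λ { (suc j) _ (s≤s le) → pos (suc (suc j)) (s≤s z≤n) (s≤s (s≤s le)) })
                                       (λ { (suc j) _ (s≤s lt) → dec (suc (suc j)) (s≤s z≤n) (s≤s (s≤s lt)) })
  ... | (l , a) = dec 1 (s≤s z≤n) (s≤s (s≤s z≤n)) ∷ l , pos 1 (s≤s z≤n) (s≤s z≤n) ∷ a

  part-++ˡ : ∀ xs ys j → 1 ≤ j → j ≤ length xs → part (xs ++ ys) j ≡ part xs j
  part-++ˡ (x ∷ xs) ys (suc zero) _ _ = refl
  part-++ˡ (x ∷ xs) ys (suc (suc j)) _ (s≤s le) = part-++ˡ xs ys (suc j) (s≤s z≤n) le

  part-++ʳ : ∀ xs ys s → 1 ≤ s → part (xs ++ ys) (length xs + s) ≡ part ys s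
  part-++ʳ [] ys s _ = refl
  part-++ʳ (x ∷ xs) ys (suc s) _ =
    trans (cong (λ z → part (x ∷ (xs ++ ys)) (suc z)) (ℕP.+-suc (length xs) s))
          (trans (cong (part (xs ++ ys)) (sym (ℕP.+-suc (length xs) s))) (part-++ʳ xs ys (suc s) (s≤s z≤n)))

  row-split : ∀ n j → (j ≤ n) ⊎ (Σ ℕ λ s → 1 ≤ s × j ≡ n + s)
  row-split n j with j ℕ.≤? n
  ... | yes le = inj₁ le
  ... | no nle = inj₂ (j ∸ n , ℕP.m<n⇒0<n∸m (ℕP.≰⇒> nle) , sym (ℕP.m+[n∸m]≡n (ℕP.<⇒≤ (ℕP.≰⇒> nle))))

  module CorrParts (m n : ℕ) (δ γ : List ℕ) where
    private
      top : List ℕ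
      top = map (λ j → m + part δ j) (oneTo n)

    corr-top : ∀ j → 1 ≤ j → j ≤ n → part (corr m n δ γ) j ≡ m + part δ j
    corr-top j 1≤j le = trans (part-++ˡ top (conj γ) j 1≤j (subst (j ≤_) (sym (length-mapOneTo _ n)) le))
                              (part-mapOneTo _ n j 1≤j le)

    corr-bottom : ∀ s → 1 ≤ s → part (corr m n δ γ) (n + s) ≡ part (conj γ) s
    corr-bottom s 1≤s = trans (cong (λ z → part (corr m n δ γ) (z + s)) (sym (length-mapOneTo _ n)))
                              (part-++ʳ top (conj γ) s 1≤s)

    corr-length : length (corr m n δ γ) ≡ n + part γ 1
    corr-length = trans (LP.length-++ top) (cong₂ _+_ (length-mapOneTo _ n) (conj-length γ))

    corr-isPartition : IsPartition δ → IsPartition γ → length γ ≤ m → 1 ≤ m → IsPartition (corr m n δ γ)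
    corr-isPartition Pδ Pγ len 1≤m = isPartition-fromParts _ pos dec
      where
        pos : ∀ j → 1 ≤ j → j ≤ length (corr m n δ γ) → 1 ≤ part (corr m n δ γ) j
        pos j 1≤j le with row-split n j
        ... | inj₁ jn = subst (1 ≤_) (sym (corr-top j 1≤j jn)) (ℕP.≤-trans 1≤m (ℕP.m≤m+n m _))
        ... | inj₂ (s , 1≤s , refl) = subst (1 ≤_) (sym (corr-bottom s 1≤s))
                 (proj₂ (conj-spec Pγ 1 s (s≤s z≤n) 1≤s) (ℕP.+-cancelˡ-≤ n s _ (subst (n + s ≤_) corr-length le)))
        -- the step from row n to row n + 1 uses γ'_1 ≤ m
        dec : ∀ j → 1 ≤ j → j < length (corr m n δ γ) → part (corr m n δ γ) (suc j) ≤ part (corr m n δ γ) j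
        dec j 1≤j lt with row-split n j
        ... | inj₂ (s , 1≤s , refl) =
                 subst₂ _≤_ (sym (trans (cong (part (corr m n δ γ)) (sym (ℕP.+-suc n s))) (corr-bottom (suc s) (s≤s z≤n))))
                            (sym (corr-bottom s 1≤s))
                            (part-antitone (conj-isPartition Pγ) s (suc s) 1≤s (ℕP.n≤1+n s))
        ... | inj₁ jn with suc j ℕ.≤? n
        ... | yes sjn = subst₂ _≤_ (sym (corr-top (suc j) (s≤s z≤n) sjn)) (sym (corr-top j 1≤j jn))
                                   (ℕP.+-monoʳ-≤ m (part-antitone Pδ j (suc j) 1≤j (ℕP.n≤1+n j)))
        ... | no nsjn = subst₂ _≤_ (sym (trans (cong (part (corr m n δ γ)) (trans (cong suc j≡n) (ℕP.+-comm 1 n))) (corr-bottom 1 (s≤s z≤n))))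
                                   (sym (corr-top j 1≤j jn))
                                   (ℕP.≤-trans (conj-part≤ Pγ len 1) (ℕP.m≤m+n m _))
          where j≡n : j ≡ n
                j≡n = ℕP.≤-antisym jn (ℕP.≤-pred (ℕP.≰⇒> nsjn))

  -- corr is injective on pairs with δ having at most n parts: the top rows
  -- recover δ, the bottom rows recover γ', hence γ.
  corr-injective : ∀ m n {δ γ δ₁ γ₁} → IsPartition δ → IsPartition γ → IsPartition δ₁ → IsPartition γ₁ →
    length δ ≤ n → length δ₁ ≤ n → corr m n δ γ ≡ corr m n δ₁ γ₁ → δ ≡ δ₁ × γ ≡ γ₁
  corr-injective m n {δ} {γ} {δ₁} {γ₁} Pδ Pγ Pδ₁ Pγ₁ lδ lδ₁ eq = partExt Pδ Pδ₁ sameδ , partExt Pγ Pγ₁ sameγ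
    where
      module C₀ = CorrParts m n δ γ
      module C₁ = CorrParts m n δ₁ γ₁
      sameδ : ∀ j → 1 ≤ j → part δ j ≡ part δ₁ j
      sameδ j 1≤j with j ℕ.≤? n
      ... | yes jn = ℕP.+-cancelˡ-≡ m _ _ (trans (sym (C₀.corr-top j 1≤j jn)) (trans (cong (λ z → part z j) eq) (C₁.corr-top j 1≤j jn)))
      ... | no njn = trans (partZero δ j (ℕP.≤-<-trans lδ (ℕP.≰⇒> njn))) (sym (partZero δ₁ j (ℕP.≤-<-trans lδ₁ (ℕP.≰⇒> njn))))
      sameConj : ∀ s → 1 ≤ s → part (conj γ) s ≡ part (conj γ₁) s
      sameConj s 1≤s = trans (sym (C₀.corr-bottom s 1≤s)) (trans (cong (λ z → part z (n + s)) eq) (C₁.corr-bottom s 1≤s))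
      transfer : ∀ {γ γ₁} → IsPartition γ → IsPartition γ₁ → (∀ s → 1 ≤ s → part (conj γ) s ≡ part (conj γ₁) s) →
        ∀ i → 1 ≤ i → ∀ s → 1 ≤ s → s ≤ part γ i → s ≤ part γ₁ i
      transfer P P₁ same i 1≤i s 1≤s le =
        proj₁ (conj-spec P₁ i s 1≤i 1≤s) (subst (i ≤_) (same s 1≤s) (proj₂ (conj-spec P i s 1≤i 1≤s) le))
      sameγ : ∀ i → 1 ≤ i → part γ i ≡ part γ₁ i
      sameγ i 1≤i = ≡-by-elements _ _ (transfer Pγ Pγ₁ sameConj i 1≤i) (transfer Pγ₁ Pγ (λ s 1≤s → sym (sameConj s 1≤s)) i 1≤i)

module Ribbons where

  open Partitions
  open import Data.Nat as ℕ using (zero; suc; _+_; z≤n; s≤s)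
  import Data.Nat.Properties as ℕP
  open import Data.Nat.ListAction using (sum)
  import Data.Nat.ListAction.Properties as SP
  open import Data.List using ([]; _∷_; length; map; filter; upTo; _++_)
  import Data.List.Properties as LP
  open import Data.Product using (proj₁; proj₂)
  open import Data.Sum using (_⊎_; inj₁; inj₂)
  open import Data.Empty using (⊥-elim)
  open import Relation.Nullary using (¬_; yes; no)
  open import Relation.Unary using (Decidable)
  open import Relation.Binary.PropositionalEquality

  oneTo-suc : ∀ N → oneTo (suc N) ≡ oneTo N ++ (suc N ∷ [])
  oneTo-suc N = trans (cong (map suc) (sym (LP.upTo-∷ʳ N))) (LP.map-++ suc (upTo N) (N ∷ []))

  sum-oneTo-suc : ∀ (h : ℕ → ℕ) N → sum (map h (oneTo (suc N))) ≡ sum (map h (oneTo N)) + h (suc N)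
  sum-oneTo-suc h N = trans (cong (λ z → sum (map h z)) (oneTo-suc N)) (trans (cong sum (LP.map-++ h (oneTo N) (suc N ∷ [])))
    (trans (SP.sum-++ (map h (oneTo N)) (h (suc N) ∷ [])) (cong (sum (map h (oneTo N)) +_) (ℕP.+-identityʳ _))))

  count-oneTo-suc : ∀ {P : ℕ → Set} (P? : Decidable P) N → length (filter P? (oneTo (suc N))) ≡ length (filter P? (oneTo N)) + length (filter P? (suc N ∷ []))
  count-oneTo-suc P? N = trans (cong (λ z → length (filter P? z)) (oneTo-suc N)) (trans (cong length (LP.filter-++ P? (oneTo N) (suc N ∷ []))) (LP.length-++ (filter P? (oneTo N))))

  count-one : ∀ {P : ℕ → Set} (P? : Decidable P) x → P x → length (filter P? (x ∷ [])) ≡ 1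
  count-one P? x px = cong length (LP.filter-accept P? px)

  count-none : ∀ {P : ℕ → Set} (P? : Decidable P) x → ¬ P x → length (filter P? (x ∷ [])) ≡ 0
  count-none P? x npx = cong length (LP.filter-reject P? npx)

  -- λ ∖ μ occupies exactly the rows a … b, and consecutive rows overlap in
  -- exactly one column: λ_{j+1} = μ_j + 1.
  record RowRibbon (μ ν : List ℕ) (a b : ℕ) : Set where
    field
      1≤a : 1 ≤ a
      a≤b : a ≤ b
      below : ∀ j → 1 ≤ j → j < a → part ν j ≡ part μ j
      above : ∀ j → b < j → part ν j ≡ part μ j
      inside : ∀ j → a ≤ j → j ≤ b → part μ j < part ν j
      link : ∀ j → a ≤ j → j < b → part ν (suc j) ≡ suc (part μ j)

  module Paths (P : Box → Set) where
    path-start : ∀ {x y} → Path P x y → P x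
    path-start (here px) = px
    path-start (step px _ _) = px

    _++p_ : ∀ {x y z} → Path P x y → Path P y z → Path P x z
    here _ ++p q = q
    step px adj p ++p q = step px adj (p ++p q)

    adjacent-sym : ∀ {x y} → Adjacent x y → Adjacent y x
    adjacent-sym (inj₁ (e1 , e2)) = inj₂ (inj₁ (e1 , sym e2))
    adjacent-sym (inj₂ (inj₁ (e1 , e2))) = inj₁ (e1 , sym e2)
    adjacent-sym (inj₂ (inj₂ (inj₁ (e1 , e2)))) = inj₂ (inj₂ (inj₂ (e1 , sym e2)))
    adjacent-sym (inj₂ (inj₂ (inj₂ (e1 , e2)))) = inj₂ (inj₂ (inj₁ (e1 , sym e2)))

    snoc : ∀ {x y z} → Path P x y → Adjacent y z → P z → Path P x z
    snoc (here py) adj pz = step py adj (here pz)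
    snoc (step px adj' p) adj pz = step px adj' (snoc p adj pz)

    reverse : ∀ {x y} → Path P x y → Path P y x
    reverse (here px) = here px
    reverse (step px adj p) = snoc (reverse p) (adjacent-sym adj) px

  module RowRibbonIsRibbon {μ ν : List ℕ} (Pμ : IsPartition μ) (Pν : IsPartition ν) {a b : ℕ} (R : RowRibbon μ ν a b) where
    open RowRibbon R
    S : Box → Set
    S = InSkew μ ν
    open Paths S

    nonemptyRow-inRange : ∀ j → 1 ≤ j → part μ j < part ν j → a ≤ j × j ≤ b
    nonemptyRow-inRange j 1≤j lt with a ℕ.≤? j | j ℕ.≤? b
    ... | yes p | yes q = p , q
    ... | no p | _ = ⊥-elim (ℕP.<-irrefl (sym (below j 1≤j (ℕP.≰⇒> p))) lt)
    ... | _ | no q = ⊥-elim (ℕP.<-irrefl (sym (above j (ℕP.≰⇒> q))) lt)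

    contained : Contained μ ν
    contained zero = z≤n
    contained (suc j) with a ℕ.≤? suc j | suc j ℕ.≤? b
    ... | yes p | yes q = ℕP.<⇒≤ (inside (suc j) p q)
    ... | no p | _ = ℕP.≤-reflexive (sym (below (suc j) (s≤s z≤n) (ℕP.≰⇒> p)))
    ... | _ | no q = ℕP.≤-reflexive (sym (above (suc j) (ℕP.≰⇒> q)))

    no2x2 : No2x2 S
    no2x2 i j ((_ , 1≤j , μj<i , i≤νj) , _ , _ , (_ , _ , μsj<si , si≤νsj)) =
      ℕP.<-irrefl refl (ℕP.<-≤-trans μj<i (ℕP.≤-pred (subst (suc i ≤_) (link j aj sjb) si≤νsj)))
      where
        aj = proj₁ (nonemptyRow-inRange j 1≤j (ℕP.<-≤-trans μj<i i≤νj))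
        sjb = proj₂ (nonemptyRow-inRange (suc j) (s≤s z≤n) (ℕP.<-≤-trans μsj<si si≤νsj))

    -- Connectedness: every box walks right to the end (λ_j , j) of its row,
    -- then steps to (λ_j , j - 1), a box of λ ∖ μ since λ_j = μ_{j-1} + 1;
    -- repeating this reaches the end (λ_a , a) of the first row.
    pathAlongRow : ∀ j d i → S (i , j) → i + d ≤ part ν j → Path S (i , j) (i + d , j)
    pathAlongRow j zero i Si le = subst (λ z → Path S (i , j) (z , j)) (sym (ℕP.+-identityʳ i)) (here Si)
    pathAlongRow j (suc d) i Si@(_ , 1≤j , μj<i , _) le =
      step Si (inj₁ (refl , refl)) (subst (λ z → Path S (suc i , j) (z , j)) (sym (ℕP.+-suc i d)) (pathAlongRow j d (suc i) S' le'))
      where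
        le' : suc i + d ≤ part ν j
        le' = subst (_≤ part ν j) (ℕP.+-suc i d) le
        S' : S (suc i , j)
        S' = s≤s z≤n , 1≤j , ℕP.≤-trans μj<i (ℕP.n≤1+n i) , ℕP.≤-trans (ℕP.m≤m+n (suc i) d) le'

    pathToRowEnd : ∀ i j → S (i , j) → Path S (i , j) (part ν j , j)
    pathToRowEnd i j Si = subst (λ z → Path S (i , j) (z , j)) e (pathAlongRow j (part ν j ∸ i) i Si (ℕP.≤-reflexive e))
      where e = ℕP.m+[n∸m]≡n (proj₂ (proj₂ (proj₂ Si)))

    pathToCorner′ : ∀ d i j → j ≡ a + d → S (i , j) → Path S (i , j) (part ν a , a)
    pathToCorner′ zero i j e Si = subst (λ z → Path S (i , j) (part ν z , z)) (trans e (ℕP.+-identityʳ a)) (pathToRowEnd i j Si)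
    pathToCorner′ (suc d) i j e Si = pathToRowEnd i j Si ++p step Se adj (pathToCorner′ d (part ν j) j' refl Se')
      where
        j' = a + d
        ej : j ≡ suc j'
        ej = trans e (ℕP.+-suc a d)
        jb : j ≤ b
        jb = proj₂ (nonemptyRow-inRange j (proj₁ (proj₂ Si)) (ℕP.<-≤-trans (proj₁ (proj₂ (proj₂ Si))) (proj₂ (proj₂ (proj₂ Si)))))
        Se : S (part ν j , j)
        Se = ℕP.≤-trans (s≤s z≤n) (inside j (subst (a ≤_) (sym e) (ℕP.m≤m+n a (suc d))) jb) , proj₁ (proj₂ Si) ,
             inside j (subst (a ≤_) (sym e) (ℕP.m≤m+n a (suc d))) jb , ℕP.≤-refl
        adj : Adjacent (part ν j , j) (part ν j , j')
        adj = inj₂ (inj₂ (inj₂ (ej , refl)))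
        lk : part ν j ≡ suc (part μ j')
        lk = trans (cong (part ν) ej) (link j' (ℕP.m≤m+n a d) (subst (_≤ b) ej jb))
        Se' : S (part ν j , j')
        Se' = subst (1 ≤_) (sym lk) (s≤s z≤n) , ℕP.≤-trans 1≤a (ℕP.m≤m+n a d) ,
              subst (part μ j' <_) (sym lk) ℕP.≤-refl ,
              part-antitone Pν j' j (ℕP.≤-trans 1≤a (ℕP.m≤m+n a d)) (subst (j' ≤_) (sym ej) (ℕP.n≤1+n j'))

    pathToCorner : ∀ x → S x → Path S x (part ν a , a)
    pathToCorner (i , j) Si = pathToCorner′ (j ∸ a) i j (sym (ℕP.m+[n∸m]≡n aj)) Si
      where aj = proj₁ (nonemptyRow-inRange j (proj₁ (proj₂ Si)) (ℕP.<-≤-trans (proj₁ (proj₂ (proj₂ Si))) (proj₂ (proj₂ (proj₂ Si)))))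

    connected : EdgeConnected S
    connected x y Sx Sy = pathToCorner x Sx ++p reverse (pathToCorner y Sy)

    -- Size: the partial sums F N = Σ_{j ≤ N} (λ_j - μ_j) telescope on a … b.
    h : ℕ → ℕ
    h j = part ν j ∸ part μ j
    F : ℕ → ℕ
    F N = sum (map h (oneTo N))

    F0 : ∀ N → N < a → F N ≡ 0
    F0 zero _ = refl
    F0 (suc N) lt = trans (sum-oneTo-suc h N) (cong₂ _+_ (F0 N (ℕP.<-trans (ℕP.n<1+n N) lt))
      (trans (cong (_∸ part μ (suc N)) (below (suc N) (s≤s z≤n) lt)) (ℕP.n∸n≡0 (part μ (suc N)))))

    Fmid : ∀ N → a ≤ N → N ≤ b → F N + part μ N ≡ part ν a + (N ∸ a)
    Fmid zero le _ = ⊥-elim (ℕP.<-irrefl refl (ℕP.<-≤-trans 1≤a le))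
    Fmid (suc N) le lb with a ℕ.≤? N
    ... | no na = begin
          F (suc N) + part μ (suc N) ≡⟨ cong (_+ part μ (suc N)) (sum-oneTo-suc h N) ⟩
          (F N + h (suc N)) + part μ (suc N) ≡⟨ cong (λ z → (z + h (suc N)) + part μ (suc N)) (F0 N (ℕP.≰⇒> na)) ⟩
          h (suc N) + part μ (suc N) ≡⟨ ℕP.m∸n+n≡m (contained (suc N)) ⟩
          part ν (suc N) ≡⟨ cong (part ν) (sym ea) ⟩
          part ν a ≡⟨ sym (ℕP.+-identityʳ _) ⟩
          part ν a + 0 ≡⟨ cong (part ν a +_) (sym (trans (cong (suc N ∸_) ea) (ℕP.n∸n≡0 (suc N)))) ⟩
          part ν a + (suc N ∸ a) ∎
      where open ≡-Reasoning
            ea : a ≡ suc N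
            ea = ℕP.≤-antisym le (ℕP.≰⇒> na)
    ... | yes aN = begin
          F (suc N) + part μ (suc N) ≡⟨ cong (_+ part μ (suc N)) (sum-oneTo-suc h N) ⟩
          (F N + h (suc N)) + part μ (suc N) ≡⟨ ℕP.+-assoc (F N) _ _ ⟩
          F N + (h (suc N) + part μ (suc N)) ≡⟨ cong (F N +_) (ℕP.m∸n+n≡m (contained (suc N))) ⟩
          F N + part ν (suc N) ≡⟨ cong (F N +_) (link N aN lb) ⟩
          F N + suc (part μ N) ≡⟨ ℕP.+-suc (F N) _ ⟩
          suc (F N + part μ N) ≡⟨ cong suc (Fmid N aN (ℕP.<⇒≤ lb)) ⟩
          suc (part ν a + (N ∸ a)) ≡⟨ sym (ℕP.+-suc _ _) ⟩
          part ν a + suc (N ∸ a) ≡⟨ cong (part ν a +_) (sym (ℕP.+-∸-assoc 1 aN)) ⟩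
          part ν a + (suc N ∸ a) ∎
      where open ≡-Reasoning

    Ftop : ∀ N → b ≤ N → F N ≡ F b
    Ftop N le with ℕP.m≤n⇒m<n∨m≡n le
    ... | inj₂ e = cong F (sym e)
    ... | inj₁ lt with N
    ...   | suc N' = trans (sum-oneTo-suc h N') (trans (cong₂ _+_ (Ftop N' (ℕP.≤-pred lt))
              (trans (cong (_∸ part μ (suc N')) (above (suc N') lt)) (ℕP.n∸n≡0 (part μ (suc N'))))) (ℕP.+-identityʳ _))

    b≤len : b ≤ length ν
    b≤len with b ℕ.≤? length ν
    ... | yes p = p
    ... | no p = ⊥-elim (ℕP.<-irrefl (sym (partZero ν b (ℕP.≰⇒> p))) (ℕP.<-≤-trans (s≤s z≤n) (inside b a≤b ℕP.≤-refl)))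

    μb≤νa : part μ b ≤ part ν a
    μb≤νa = ℕP.≤-trans (part-antitone Pμ a b 1≤a a≤b) (ℕP.<⇒≤ (inside a ℕP.≤-refl a≤b))

    size : skewSize μ ν ≡ part ν a ∸ part μ b + (b ∸ a)
    size = begin
      F (length ν) ≡⟨ Ftop (length ν) b≤len ⟩
      F b ≡⟨ sym (ℕP.m+n∸n≡m (F b) (part μ b)) ⟩
      (F b + part μ b) ∸ part μ b ≡⟨ cong (_∸ part μ b) (Fmid b a≤b ℕP.≤-refl) ⟩
      (part ν a + (b ∸ a)) ∸ part μ b ≡⟨ ℕP.+-∸-comm (b ∸ a) μb≤νa ⟩
      part ν a ∸ part μ b + (b ∸ a) ∎
      where open ≡-Reasoning

    P? = λ j → part μ j ℕ.<? part ν j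
    C : ℕ → ℕ
    C N = length (filter P? (oneTo N))

    C0 : ∀ N → N < a → C N ≡ 0
    C0 zero _ = refl
    C0 (suc N) lt = trans (count-oneTo-suc P? N) (cong₂ _+_ (C0 N (ℕP.<-trans (ℕP.n<1+n N) lt))
       (count-none P? (suc N) (λ l → ℕP.<-irrefl (sym (below (suc N) (s≤s z≤n) lt)) l)))

    Cmid : ∀ N → a ≤ N → N ≤ b → C N ≡ suc (N ∸ a)
    Cmid zero le _ = ⊥-elim (ℕP.<-irrefl refl (ℕP.<-≤-trans 1≤a le))
    Cmid (suc N) le lb with a ℕ.≤? N
    ... | no na = trans (count-oneTo-suc P? N) (trans (cong₂ _+_ (C0 N (ℕP.≰⇒> na)) (count-one P? (suc N) (inside (suc N) le lb)))
                   (cong suc (sym (trans (cong (suc N ∸_) ea) (ℕP.n∸n≡0 (suc N))))))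
      where ea : a ≡ suc N
            ea = ℕP.≤-antisym le (ℕP.≰⇒> na)
    ... | yes aN = trans (count-oneTo-suc P? N) (trans (cong₂ _+_ (Cmid N aN (ℕP.<⇒≤ lb)) (count-one P? (suc N) (inside (suc N) le lb)))
                   (trans (ℕP.+-comm _ 1) (cong suc (sym (ℕP.+-∸-assoc 1 aN)))))

    Ctop : ∀ N → b ≤ N → C N ≡ C b
    Ctop N le with ℕP.m≤n⇒m<n∨m≡n le
    ... | inj₂ e = cong C (sym e)
    ... | inj₁ lt with N
    ...   | suc N' = trans (count-oneTo-suc P? N') (trans (cong₂ _+_ (Ctop N' (ℕP.≤-pred lt))
              (count-none P? (suc N') (λ l → ℕP.<-irrefl (sym (above (suc N') lt)) l))) (ℕP.+-identityʳ _))

    height : ht μ ν ≡ b ∸ a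
    height = cong (_∸ 1) (trans (Ctop (length ν) b≤len) (Cmid b a≤b ℕP.≤-refl))

    isRibbon : IsRibbon (part ν a ∸ part μ b + (b ∸ a)) μ ν
    isRibbon = contained , size , connected , no2x2


  module Search (P : ℕ → Set) (P? : Decidable P) where
    findFirst : ∀ L → (∀ j → 1 ≤ j → j ≤ L → ¬ P j) ⊎ Σ ℕ λ j → 1 ≤ j × j ≤ L × P j × (∀ j' → 1 ≤ j' → j' < j → ¬ P j')
    findFirst zero = inj₁ λ { zero () ; (suc j) _ () }
    findFirst (suc L) with findFirst L
    ... | inj₂ (j , 1≤j , jL , pj , mn) = inj₂ (j , 1≤j , ℕP.m≤n⇒m≤1+n jL , pj , mn)
    ... | inj₁ none with P? (suc L)
    ...   | yes p = inj₂ (suc L , s≤s z≤n , ℕP.≤-refl , p , λ j' 1≤j' lt → none j' 1≤j' (ℕP.≤-pred lt))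
    ...   | no np = inj₁ λ j 1≤j le → ext j 1≤j le
      where ext : ∀ j → 1 ≤ j → j ≤ suc L → ¬ P j
            ext j 1≤j le with j ℕ.≤? L
            ... | yes jL = none j 1≤j jL
            ... | no n = λ pj → np (subst P (ℕP.≤-antisym le (ℕP.≰⇒> n)) pj)
    findLast : ∀ L → (∀ j → 1 ≤ j → j ≤ L → ¬ P j) ⊎ Σ ℕ λ j → 1 ≤ j × j ≤ L × P j × (∀ j' → j < j' → j' ≤ L → ¬ P j')
    findLast zero = inj₁ λ { zero () ; (suc j) _ () }
    findLast (suc L) with P? (suc L)
    ... | yes p = inj₂ (suc L , s≤s z≤n , ℕP.≤-refl , p , λ j' lt le → ⊥-elim (ℕP.<-irrefl refl (ℕP.<-≤-trans lt le)))
    ... | no np with findLast L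
    ...   | inj₂ (j , 1≤j , jL , pj , mx) = inj₂ (j , 1≤j , ℕP.m≤n⇒m≤1+n jL , pj , λ j' lt le → ext j' lt le)
      where ext : ∀ j' → j < j' → j' ≤ suc L → ¬ P j'
            ext j' lt le with j' ℕ.≤? L
            ... | yes jL' = mx j' lt jL'
            ... | no n = λ pj' → np (subst P (ℕP.≤-antisym le (ℕP.≰⇒> n)) pj')
    ...   | inj₁ none = inj₁ λ j 1≤j le → ext j 1≤j le
      where ext : ∀ j → 1 ≤ j → j ≤ suc L → ¬ P j
            ext j 1≤j le with j ℕ.≤? L
            ... | yes jL = none j 1≤j jL
            ... | no n = λ pj → np (subst P (ℕP.≤-antisym le (ℕP.≰⇒> n)) pj)

  -- Conversely, an r-ribbon (r ≥ 1) is a row ribbon: take a and b to be the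
  -- first and the last nonempty row; a path between the end boxes of these rows
  -- crosses every row boundary in between, and no 2×2 block forces overlaps of
  -- exactly one column.
  module RibbonRows {μ ν : List ℕ} (Pμ : IsPartition μ) (Pν : IsPartition ν) {r : ℕ} (1≤r : 1 ≤ r) (Rb : IsRibbon r μ ν) where
    S : Box → Set
    S = InSkew μ ν
    open Paths S
    cont : Contained μ ν
    cont = proj₁ Rb
    sz : skewSize μ ν ≡ r
    sz = proj₁ (proj₂ Rb)
    conn : EdgeConnected S
    conn = proj₁ (proj₂ (proj₂ Rb))
    n22 : No2x2 S
    n22 = proj₂ (proj₂ (proj₂ Rb))
    P : ℕ → Set
    P j = part μ j < part ν j
    P? : Decidable P
    P? j = part μ j ℕ.<? part ν j
    open Search P P?
    L : ℕ
    L = length ν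

    equalRow : ∀ j → ¬ P j → part ν j ≡ part μ j
    equalRow j np = ℕP.≤-antisym (ℕP.≮⇒≥ np) (cont j)

    h : ℕ → ℕ
    h j = part ν j ∸ part μ j

    sum-emptyRows : ∀ N → (∀ j → 1 ≤ j → j ≤ N → ¬ P j) → sum (map h (oneTo N)) ≡ 0
    sum-emptyRows zero _ = refl
    sum-emptyRows (suc N) none = trans (sum-oneTo-suc h N) (cong₂ _+_ (sum-emptyRows N (λ j 1≤j le → none j 1≤j (ℕP.m≤n⇒m≤1+n le)))
       (trans (cong (_∸ part μ (suc N)) (equalRow (suc N) (none (suc N) (s≤s z≤n) ℕP.≤-refl))) (ℕP.n∸n≡0 (part μ (suc N)))))

    emptyBeyond : ∀ j → L < j → ¬ P j
    emptyBeyond j lt p = ℕP.n≮0 (subst (part μ j <_) (partZero ν j lt) p)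

    crossing : ∀ j {x y} → Path S x y → proj₂ x ≤ j → suc j ≤ proj₂ y → Σ ℕ λ i → S (i , j) × S (i , suc j)
    crossing j (here _) le lt = ⊥-elim (ℕP.<-irrefl refl (ℕP.<-≤-trans lt le))
    crossing j (step {i , jx} {i' , jz} Sx adj p) le lt with jz ℕ.≤? j
    ... | yes jzj = crossing j p jzj lt
    ... | no njz = go adj
      where
        gt : suc j ≤ jz
        gt = ℕP.≰⇒> njz
        go : Adjacent (i , jx) (i' , jz) → Σ ℕ λ i → S (i , j) × S (i , suc j)
        go (inj₁ (_ , refl)) = ⊥-elim (njz le)
        go (inj₂ (inj₁ (_ , refl))) = ⊥-elim (njz le)
        go (inj₂ (inj₂ (inj₁ (refl , refl)))) = i , subst (λ z → S (i , z)) ejx Sx , subst (λ z → S (i , suc z)) ejx (path-start p)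
          where ejx : jx ≡ j
                ejx = ℕP.≤-antisym le (ℕP.≤-pred gt)
        go (inj₂ (inj₂ (inj₂ (refl , refl)))) = ⊥-elim (ℕP.<-irrefl refl (ℕP.<-≤-trans (ℕP.<-≤-trans gt (ℕP.n≤1+n jz)) le))

    rowRibbon : Σ ℕ λ a → Σ ℕ λ b → RowRibbon μ ν a b
    rowRibbon with findFirst L | findLast L
    ... | inj₁ none | _ = ⊥-elim (ℕP.<-irrefl (sym (trans (sym sz) (sum-emptyRows L none))) 1≤r)
    ... | _ | inj₁ none = ⊥-elim (ℕP.<-irrefl (sym (trans (sym sz) (sum-emptyRows L none))) 1≤r)
    ... | inj₂ (a , 1≤a , aL , pa , mn) | inj₂ (b , 1≤b , bL , pb , mx) = a , b , record
          { 1≤a = 1≤a ; a≤b = a≤b ; below = below ; above = above ; inside = inside ; link = link }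
      where
        a≤b : a ≤ b
        a≤b = ℕP.≮⇒≥ (λ lt → mn b 1≤b lt pb)
        boxA : S (part ν a , a)
        boxA = ℕP.≤-trans (s≤s z≤n) pa , 1≤a , pa , ℕP.≤-refl
        boxB : S (part ν b , b)
        boxB = ℕP.≤-trans (s≤s z≤n) pb , 1≤b , pb , ℕP.≤-refl
        pth = conn _ _ boxA boxB
        cr : ∀ j → a ≤ j → j < b → Σ ℕ λ i → S (i , j) × S (i , suc j)
        cr j aj jb = crossing j pth aj jb
        below : ∀ j → 1 ≤ j → j < a → part ν j ≡ part μ j
        below j 1≤j lt = equalRow j (mn j 1≤j lt)
        above : ∀ j → b < j → part ν j ≡ part μ j
        above j lt with j ℕ.≤? L
        ... | yes jL = equalRow j (mx j lt jL)
        ... | no n = equalRow j (emptyBeyond j (ℕP.≰⇒> n))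
        inside : ∀ j → a ≤ j → j ≤ b → part μ j < part ν j
        inside j aj jb with ℕP.m≤n⇒m<n∨m≡n jb
        ... | inj₂ refl = pb
        ... | inj₁ lt with cr j aj lt
        ...   | (i , (_ , _ , μj<i , i≤νj) , _) = ℕP.<-≤-trans μj<i i≤νj
        link : ∀ j → a ≤ j → j < b → part ν (suc j) ≡ suc (part μ j)
        link j aj lt with cr j aj lt
        ... | (i , (_ , 1≤j , μj<i , _) , (_ , _ , _ , i≤νsj)) = ℕP.≤-antisym up (ℕP.≤-trans μj<i i≤νsj)
          where
            up : part ν (suc j) ≤ suc (part μ j)
            up = ℕP.≮⇒≥ λ big →
              let i0 = suc (part μ j)
                  νj≥ : suc i0 ≤ part ν j
                  νj≥ = ℕP.≤-trans big (part-antitone Pν j (suc j) 1≤j (ℕP.n≤1+n j))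
                  μsj< : part μ (suc j) < i0
                  μsj< = s≤s (part-antitone Pμ j (suc j) 1≤j (ℕP.n≤1+n j))
              in n22 i0 j ((s≤s z≤n , 1≤j , ℕP.≤-refl , ℕP.<⇒≤ νj≥) ,
                          (s≤s z≤n , 1≤j , ℕP.n≤1+n _ , νj≥) ,
                          (s≤s z≤n , s≤s z≤n , μsj< , ℕP.<⇒≤ big) ,
                          (s≤s z≤n , s≤s z≤n , ℕP.<-trans μsj< (ℕP.n<1+n _) , big))



-- Let δ + ρ_n be the rearrangement of α(l) + ρ_n
-- with insertion position a (so δ_j + m = μ_j before a and μ_{j-1} + 1
-- after a), and γ + ρ_m that of β(l) + ρ_m with insertion position c.
-- Then λ = corr m n δ γ is a row ribbon over μ on the rows a … b with
-- b = n + γ_c, of size (δ_a + n - a) + (γ_c + m - c) + 1 = l + (r - 1 - l) + 1.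
module Forward (m n r : ℕ) (1≤m : 1 ≤ m) (1≤n : 1 ≤ n) (μ : List ℕ) (Pμ : IsPartition μ) (μn<m : part μ n < m)
  (δ γ : List ℕ) (Pδ : IsPartition δ) (Pγ : IsPartition γ) (lδ : length δ ≤ n) (lγ : length γ ≤ m)
  (l : ℕ) (l<r : l < r)
  (Iδ : Insertions.Insertion n (part δ) (part μ) m l)
  (Iγ : Insertions.Insertion m (part γ) (part (conj μ)) n (r ∸ 1 ∸ l)) where

  open Insertions using (Insertion)
  open Partitions
  open Conjugates
  open CorrMap
  open Ribbons
  open import Data.Nat as ℕ using (zero; suc; _+_; z≤n; s≤s)
  import Data.Nat.Properties as ℕP
  open import Data.Nat.Tactic.RingSolver using (solve-∀)
  open import Data.Product using (proj₁; proj₂)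
  open import Data.Sum using (inj₁; inj₂)
  open import Data.Empty using (⊥-elim)
  open import Relation.Nullary using (yes; no)
  open import Relation.Binary using (tri<; tri≈; tri>)
  open import Relation.Binary.PropositionalEquality

  open Insertion Iδ using (a; 1≤a) renaming (a≤k to a≤n; before to δ-before; after to δ-after; at to δ-at)
  open Insertion Iγ using () renaming (a to c; 1≤a to 1≤c; a≤k to c≤m; before to γ-before; after to γ-after; at to γ-at)
  open CorrParts m n δ γ

  λ₀ : List ℕ
  λ₀ = corr m n δ γ
  L : ℕ → ℕ
  L = part λ₀
  μ′ : ℕ → ℕ
  μ′ = part (conj μ)
  g : ℕ → ℕ
  g = part γ
  b : ℕ
  b = n + g c

  -- the insertion equations for γ, with n added on the left as in corr
  n+γ-before : ∀ i → 1 ≤ i → i < c → n + g i ≡ μ′ i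
  n+γ-before i 1≤i ic = trans (ℕP.+-comm n (g i)) (γ-before i 1≤i ic)
  n+γ-after : ∀ i → c < i → i ≤ m → n + g i ≡ suc (μ′ (i ∸ 1))
  n+γ-after i ci i≤m = trans (ℕP.+-comm n (g i)) (γ-after i ci i≤m)

  γ-anti : ∀ i j → 1 ≤ i → i ≤ j → g j ≤ g i
  γ-anti = part-antitone Pγ
  μ-anti : ∀ i j → 1 ≤ i → i ≤ j → part μ j ≤ part μ i
  μ-anti = part-antitone Pμ
  μ′-anti : ∀ i j → 1 ≤ i → i ≤ j → μ′ j ≤ μ′ i
  μ′-anti = part-antitone (conj-isPartition Pμ)

  μ′⇒μ : ∀ i j → 1 ≤ i → 1 ≤ j → j ≤ μ′ i → i ≤ part μ j
  μ′⇒μ i j 1≤i 1≤j = proj₁ (conj-spec Pμ j i 1≤j 1≤i)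
  μ⇒μ′ : ∀ i j → 1 ≤ i → 1 ≤ j → i ≤ part μ j → j ≤ μ′ i
  μ⇒μ′ i j 1≤i 1≤j = proj₂ (conj-spec Pμ j i 1≤j 1≤i)

  γ-beyond : ∀ i → m < i → g i ≡ 0
  γ-beyond i lt = partZero γ i (ℕP.≤-<-trans lγ lt)

  bottom⇒γ : ∀ s → 1 ≤ s → ∀ i → 1 ≤ i → i ≤ L (n + s) → s ≤ g i
  bottom⇒γ s 1≤s i 1≤i le = proj₁ (conj-spec Pγ i s 1≤i 1≤s) (subst (i ≤_) (corr-bottom s 1≤s) le)
  γ⇒bottom : ∀ s → 1 ≤ s → ∀ i → 1 ≤ i → s ≤ g i → i ≤ L (n + s)
  γ⇒bottom s 1≤s i 1≤i le = subst (i ≤_) (sym (corr-bottom s 1≤s)) (proj₂ (conj-spec Pγ i s 1≤i 1≤s) le)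

  γ-column≤m : ∀ s → 1 ≤ s → ∀ i → s ≤ g i → i ≤ m
  γ-column≤m s 1≤s i le = ℕP.≮⇒≥ λ lt → ℕP.<-irrefl refl (ℕP.<-≤-trans 1≤s (subst (s ≤_) (γ-beyond i lt) le))

  μ′c<b : μ′ c < b
  μ′c<b with ℕP.m≤n⇒m<n∨m≡n c≤m
  ... | inj₁ lt = subst (_≤ b) (γ-after (suc c) ℕP.≤-refl lt) (subst (g (suc c) + n ≤_) (ℕP.+-comm (g c) n) (ℕP.+-monoˡ-≤ n (γ-anti c (suc c) 1≤c (ℕP.n≤1+n c))))
  ... | inj₂ refl = ℕP.<-≤-trans (ℕP.≰⇒> λ nle → ℕP.<-irrefl refl (ℕP.<-≤-trans μn<m (μ′⇒μ c n 1≤c 1≤n nle))) (ℕP.m≤m+n n (g c))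

  top-row : ∀ j → 1 ≤ j → j ≤ n → L j ≡ part δ j + m
  top-row j 1≤j le = trans (corr-top j 1≤j le) (ℕP.+-comm m _)

  μa<λa : part μ a < L a
  μa<λa with ℕP.m≤n⇒m<n∨m≡n a≤n
  ... | inj₁ lt = subst (part μ a <_) (sym (top-row a 1≤a a≤n)) (subst (_≤ part δ a + m) (δ-after (suc a) ℕP.≤-refl lt)
                     (ℕP.+-monoˡ-≤ m (part-antitone Pδ a (suc a) 1≤a (ℕP.n≤1+n a))))
  ... | inj₂ refl = subst (part μ a <_) (sym (corr-top a 1≤a a≤n)) (ℕP.<-≤-trans μn<m (ℕP.m≤m+n m _))

  split-below : ∀ j → n < j → Σ ℕ λ s → 1 ≤ s × j ≡ n + s
  split-below j lt = j ∸ n , ℕP.m<n⇒0<n∸m lt , sym (ℕP.m+[n∸m]≡n (ℕP.<⇒≤ lt))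

  μ′c<n+s : ∀ s → g c < s → μ′ c < n + s
  μ′c<n+s s lt = ℕP.<-trans μ′c<b (ℕP.+-monoʳ-< n lt)

  above : ∀ j → b < j → L j ≡ part μ j
  above j bj with split-below j (ℕP.≤-<-trans (ℕP.m≤m+n n (g c)) bj)
  ... | (s , 1≤s , refl) = ≡-by-elements _ _ fw bw
    where
      gc<s : g c < s
      gc<s = ℕP.+-cancelˡ-< n _ _ bj
      1≤j = ℕP.≤-trans 1≤n (ℕP.m≤m+n n s)
      fw : ∀ i → 1 ≤ i → i ≤ L (n + s) → i ≤ part μ (n + s)
      fw i 1≤i le with bottom⇒γ s 1≤s i 1≤i le
      ... | s≤γi with ℕP.<-cmp i c
      ...   | tri< ic _ _ = μ′⇒μ i (n + s) 1≤i 1≤j (subst (n + s ≤_) (n+γ-before i 1≤i ic) (ℕP.+-monoʳ-≤ n s≤γi))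
      ...   | tri≈ _ refl _ = ⊥-elim (ℕP.<-irrefl refl (ℕP.<-≤-trans gc<s s≤γi))
      ...   | tri> _ _ ci = ⊥-elim (ℕP.<-irrefl refl (ℕP.≤-<-trans (ℕP.≤-trans n+s≤suc-μ′c μ′c<b) bj))
        where n+s≤suc-μ′c : n + s ≤ suc (μ′ c)
              n+s≤suc-μ′c = ℕP.≤-trans (ℕP.+-monoʳ-≤ n s≤γi) (ℕP.≤-trans (ℕP.≤-reflexive (n+γ-after i ci (γ-column≤m s 1≤s i s≤γi))) (s≤s (μ′-anti c (i ∸ 1) 1≤c (ℕP.<⇒≤pred ci))))
      bw : ∀ i → 1 ≤ i → i ≤ part μ (n + s) → i ≤ L (n + s)
      bw i 1≤i le with μ⇒μ′ i (n + s) 1≤i 1≤j le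
      ... | n+s≤μ′i with ℕP.<-cmp i c
      ...   | tri< ic _ _ = γ⇒bottom s 1≤s i 1≤i (ℕP.+-cancelˡ-≤ n _ _ (subst (n + s ≤_) (sym (n+γ-before i 1≤i ic)) n+s≤μ′i))
      ...   | tri≈ _ refl _ = ⊥-elim (ℕP.<-irrefl refl (ℕP.<-≤-trans (μ′c<n+s s gc<s) n+s≤μ′i))
      ...   | tri> _ _ ci = ⊥-elim (ℕP.<-irrefl refl (ℕP.<-≤-trans (μ′c<n+s s gc<s) (ℕP.≤-trans n+s≤μ′i (μ′-anti c i 1≤c (ℕP.<⇒≤ ci)))))

  n≤j-of : ∀ s j → 1 ≤ s → suc j ≡ n + s → n ≤ j
  n≤j-of s j 1≤s e = ℕP.≤-pred (subst (n <_) (sym e) (subst (_≤ n + s) (ℕP.+-comm n 1) (ℕP.+-monoʳ-≤ n 1≤s)))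

  -- column c - 1 of μ reaches row b, as μ'_{c-1} = n + γ_{c-1} ≥ n + γ_c = b
  c≤suc-μb : c ≤ suc (part μ b)
  c≤suc-μb = byPredecessor (c ∸ 1) (ℕP.m+[n∸m]≡n 1≤c)
    where
      byPredecessor : ∀ c' → suc c' ≡ c → c ≤ suc (part μ b)
      byPredecessor zero suc-c′≡c = subst (_≤ suc (part μ b)) suc-c′≡c (s≤s z≤n)
      byPredecessor (suc c'') suc-c′≡c = subst (_≤ suc (part μ b)) suc-c′≡c (s≤s (μ′⇒μ (suc c'') b (s≤s z≤n) (ℕP.≤-trans 1≤n (ℕP.m≤m+n n _))
          (subst (b ≤_) (n+γ-before (suc c'') (s≤s z≤n) (subst (suc c'' <_) suc-c′≡c ℕP.≤-refl))
            (ℕP.+-monoʳ-≤ n (γ-anti (suc c'') c (s≤s z≤n) (subst (suc c'' ≤_) suc-c′≡c (ℕP.n≤1+n _)))))))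

  link-bottom : ∀ s → 1 ≤ s → s ≤ g c → ∀ j → suc j ≡ n + s → L (n + s) ≡ suc (part μ j)
  link-bottom s 1≤s s≤γc j e = ≡-by-elements _ _ fw bw
    where
      n≤j : n ≤ j
      n≤j = n≤j-of s j 1≤s e
      1≤j = ℕP.≤-trans 1≤n n≤j
      suc-j≤b : suc j ≤ b
      suc-j≤b = subst (_≤ b) (sym e) (ℕP.+-monoʳ-≤ n s≤γc)
      fw : ∀ i → 1 ≤ i → i ≤ L (n + s) → i ≤ suc (part μ j)
      fw zero () _
      fw (suc i') 1≤i le with bottom⇒γ s 1≤s (suc i') 1≤i le
      ... | s≤γi with ℕP.<-cmp (suc i') c
      ...   | tri< ic _ _ = ℕP.m≤n⇒m≤1+n (μ′⇒μ (suc i') j 1≤i 1≤j (ℕP.<⇒≤ (subst (_≤ μ′ (suc i')) (sym e) (subst (n + s ≤_) (n+γ-before (suc i') 1≤i ic) (ℕP.+-monoʳ-≤ n s≤γi)))))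
      ...   | tri≈ _ i≡c _ = subst (_≤ suc (part μ j)) (sym i≡c) (ℕP.≤-trans c≤suc-μb (s≤s (μ-anti j b 1≤j (ℕP.≤-trans (ℕP.n≤1+n j) suc-j≤b))))
      ...   | tri> _ _ ci = s≤s (μ′⇒μ i' j (ℕP.≤-trans 1≤c (ℕP.≤-pred ci)) 1≤j
               (ℕP.≤-pred (subst (_≤ suc (μ′ i')) (sym e) (ℕP.≤-trans (ℕP.+-monoʳ-≤ n s≤γi) (ℕP.≤-reflexive (n+γ-after (suc i') ci (γ-column≤m s 1≤s (suc i') s≤γi)))))))
      bw : ∀ i → 1 ≤ i → i ≤ suc (part μ j) → i ≤ L (n + s)
      bw zero () _
      bw (suc i') 1≤i le = γ⇒bottom s 1≤s (suc i') 1≤i s≤γi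
        where
          s≤γi : s ≤ g (suc i')
          s≤γi with ℕP.<-cmp (suc i') c
          ... | tri< ic _ _ = ℕP.≤-trans s≤γc (γ-anti (suc i') c 1≤i (ℕP.<⇒≤ ic))
          ... | tri≈ _ refl _ = s≤γc
          ... | tri> _ _ ci = ℕP.+-cancelˡ-≤ n _ _
                  (subst₂ _≤_ e (sym (n+γ-after (suc i') ci i≤m)) (s≤s (μ⇒μ′ i' j 1≤i' 1≤j (ℕP.≤-pred le))))
            where
              1≤i' = ℕP.≤-trans 1≤c (ℕP.≤-pred ci)
              i≤m : suc i' ≤ m
              i≤m = ℕP.≤-trans (s≤s (ℕP.≤-pred le)) (ℕP.≤-trans (s≤s (μ-anti n j 1≤n n≤j)) μn<m)

  -- rows a … b of λ ∖ μ are linked (in the top part by the insertion for δ)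
  link : ∀ j → a ≤ j → j < b → L (suc j) ≡ suc (part μ j)
  link j aj jb with suc j ℕ.≤? n
  ... | yes sjn = trans (top-row (suc j) (s≤s z≤n) sjn) (δ-after (suc j) (s≤s aj) sjn)
  ... | no nsjn with split-below (suc j) (ℕP.≰⇒> nsjn)
  ...   | (s , 1≤s , e) = trans (cong L e) (link-bottom s 1≤s (ℕP.+-cancelˡ-≤ n _ _ (subst (_≤ b) e jb)) j e)

  inside : ∀ j → a ≤ j → j ≤ b → part μ j < L j
  inside j aj jb with ℕP.m≤n⇒m<n∨m≡n aj
  ... | inj₂ refl = μa<λa
  ... | inj₁ lt with j
  ...   | suc j' = subst (part μ (suc j') <_) (sym (link j' (ℕP.≤-pred lt) jb))
                    (s≤s (μ-anti j' (suc j') (ℕP.≤-trans 1≤a (ℕP.≤-pred lt)) (ℕP.n≤1+n j')))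

  below : ∀ j → 1 ≤ j → j < a → L j ≡ part μ j
  below j 1≤j lt = trans (top-row j 1≤j (ℕP.≤-trans (ℕP.<⇒≤ lt) a≤n)) (δ-before j 1≤j lt)

  rowRibbon : RowRibbon μ λ₀ a b
  rowRibbon = record { 1≤a = 1≤a ; a≤b = ℕP.≤-trans a≤n (ℕP.m≤m+n n (g c)) ; below = below ; above = above ; inside = inside ; link = link }

  suc-μb≡c : suc (part μ b) ≡ c
  suc-μb≡c = ℕP.≤-antisym lt c≤suc-μb
    where
      lt : suc (part μ b) ≤ c
      lt = ℕP.≮⇒≥ λ cb → ℕP.<-irrefl refl (ℕP.<-≤-trans μ′c<b (μ⇒μ′ c b 1≤c (ℕP.≤-trans 1≤n (ℕP.m≤m+n n _)) (ℕP.≤-pred cb)))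

  ∸-pred : ∀ x y → 1 ≤ y → y ≤ x → x ∸ (y ∸ 1) ≡ suc (x ∸ y)
  ∸-pred (suc x) (suc zero) _ _ = refl
  ∸-pred (suc x) (suc (suc y)) _ (s≤s le) = ∸-pred x (suc y) (s≤s z≤n) le

  -- λ_a - μ_b + (b - a) = (δ_a + n - a) + (γ_c + m - c) + 1 = l + (r - 1 - l) + 1
  ribbon-size : L a ∸ part μ b + (b ∸ a) ≡ r
  ribbon-size = begin
    L a ∸ part μ b + (b ∸ a) ≡⟨ cong₂ (λ x y → x ∸ y + (b ∸ a)) (top-row a 1≤a a≤n) (cong (_∸ 1) suc-μb≡c) ⟩
    (part δ a + m) ∸ (c ∸ 1) + (b ∸ a) ≡⟨ cong (_+ (b ∸ a)) (ℕP.+-∸-assoc (part δ a) (ℕP.≤-trans (ℕP.∸-monoˡ-≤ 1 c≤m) (ℕP.m∸n≤m m 1))) ⟩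
    part δ a + (m ∸ (c ∸ 1)) + (b ∸ a) ≡⟨ cong₂ (λ x y → part δ a + x + y) (∸-pred m c 1≤c c≤m) (ℕP.+-∸-comm (g c) a≤n) ⟩
    part δ a + suc (m ∸ c) + ((n ∸ a) + g c) ≡⟨ arith (part δ a) (m ∸ c) (n ∸ a) (g c) ⟩
    suc ((part δ a + (n ∸ a)) + (g c + (m ∸ c))) ≡⟨ cong suc (cong₂ _+_ δ-at γ-at) ⟩
    suc (l + (r ∸ 1 ∸ l)) ≡⟨ cong suc (ℕP.m+[n∸m]≡n (ℕP.<⇒≤pred l<r)) ⟩
    suc (r ∸ 1) ≡⟨ ℕP.suc-pred r ⦃ ℕ.>-nonZero (ℕP.≤-<-trans z≤n l<r) ⦄ ⟩
    r ∎
    where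
      open ≡-Reasoning
      arith : ∀ d u v w → d + suc u + (v + w) ≡ suc ((d + v) + (w + u))
      arith = solve-∀

  Pλ : IsPartition λ₀
  Pλ = corr-isPartition Pδ Pγ lγ 1≤m

  target : InTarget m n r μ λ₀
  target = Pλ , subst (λ z → IsRibbon z μ λ₀) ribbon-size (RowRibbonIsRibbon.isRibbon Pμ Pλ rowRibbon) ,
           subst (m ≤_) (sym (corr-top n 1≤n ℕP.≤-refl)) (ℕP.m≤m+n m _)

  height : ht μ λ₀ ≡ b ∸ a
  height = RowRibbonIsRibbon.height Pμ Pλ rowRibbon


-- For an r-ribbon λ ∖ μ through (m , n) on the rows
-- a … b, the pair δ = (λ_j - m)_{j ≤ n}, γ = (λ'_i - n)_{i ≤ m} satisfies
-- corr m n δ γ = λ, and δ , γ are insertions into α(l) , β(l) at the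
-- positions a and c = μ_b + 1, where l = λ_a + (n - a) - m < r.
module Backward (m n r : ℕ) (1≤m : 1 ≤ m) (1≤n : 1 ≤ n) (1≤r : 1 ≤ r) (μ : List ℕ) (Pμ : IsPartition μ) (μn<m : part μ n < m)
  (λ₀ : List ℕ) (Pλ : IsPartition λ₀) (ribbon : IsRibbon r μ λ₀) (m≤λn : m ≤ part λ₀ n) where

  open Insertions using (Insertion; Antitone)
  open Partitions
  open Conjugates
  open CorrMap
  open Ribbons
  open import Data.Nat as ℕ using (zero; suc; _+_; z≤n; s≤s)
  import Data.Nat.Properties as ℕP
  open import Data.Nat.Tactic.RingSolver using (solve-∀)
  open import Data.Product using (proj₁; proj₂)
  open import Data.Sum using (_⊎_; inj₁; inj₂)
  open import Data.Empty using (⊥-elim)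
  open import Relation.Nullary using (¬_; yes; no)
  open import Relation.Binary.PropositionalEquality

  rows-of-ribbon : Σ ℕ λ a → Σ ℕ λ b → RowRibbon μ λ₀ a b
  rows-of-ribbon = RibbonRows.rowRibbon Pμ Pλ 1≤r ribbon
  a b : ℕ
  a = proj₁ rows-of-ribbon
  b = proj₁ (proj₂ rows-of-ribbon)
  rowRibbon : RowRibbon μ λ₀ a b
  rowRibbon = proj₂ (proj₂ rows-of-ribbon)
  open RowRibbon rowRibbon
  module Rib = RowRibbonIsRibbon Pμ Pλ rowRibbon

  L λ′ μ′ : ℕ → ℕ
  L = part λ₀
  λ′ = part (conj λ₀)
  μ′ = part (conj μ)

  size≡r : L a ∸ part μ b + (b ∸ a) ≡ r
  size≡r = trans (sym Rib.size) (proj₁ (proj₂ ribbon))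

  -- the ribbon passes through row n, since (m , n) ∈ λ ∖ μ
  a≤n≤b : a ≤ n × n ≤ b
  a≤n≤b = Rib.nonemptyRow-inRange n 1≤n (ℕP.<-≤-trans μn<m m≤λn)
  a≤n : a ≤ n
  a≤n = proj₁ a≤n≤b
  n≤b : n ≤ b
  n≤b = proj₂ a≤n≤b

  L-anti : ∀ i j → 1 ≤ i → i ≤ j → L j ≤ L i
  L-anti = part-antitone Pλ
  μ-anti : ∀ i j → 1 ≤ i → i ≤ j → part μ j ≤ part μ i
  μ-anti = part-antitone Pμ

  L≥m : ∀ j → 1 ≤ j → j ≤ n → m ≤ L j
  L≥m j 1≤j jn = ℕP.≤-trans m≤λn (L-anti j n 1≤j jn)

  λ′⇒L : ∀ i j → 1 ≤ i → 1 ≤ j → j ≤ λ′ i → i ≤ L j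
  λ′⇒L i j 1≤i 1≤j = proj₁ (conj-spec Pλ j i 1≤j 1≤i)
  L⇒λ′ : ∀ i j → 1 ≤ i → 1 ≤ j → i ≤ L j → j ≤ λ′ i
  L⇒λ′ i j 1≤i 1≤j = proj₂ (conj-spec Pλ j i 1≤j 1≤i)
  μ′⇒μ : ∀ i j → 1 ≤ i → 1 ≤ j → j ≤ μ′ i → i ≤ part μ j
  μ′⇒μ i j 1≤i 1≤j = proj₁ (conj-spec Pμ j i 1≤j 1≤i)
  μ⇒μ′ : ∀ i j → 1 ≤ i → 1 ≤ j → i ≤ part μ j → j ≤ μ′ i
  μ⇒μ′ i j 1≤i 1≤j = proj₂ (conj-spec Pμ j i 1≤j 1≤i)

  λ′≥n : ∀ i → 1 ≤ i → i ≤ m → n ≤ λ′ i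
  λ′≥n i 1≤i im = L⇒λ′ i n 1≤i 1≤n (ℕP.≤-trans im m≤λn)

  fδ : ℕ → ℕ
  fδ j = L j ∸ m
  fγ : ℕ → ℕ
  fγ i = λ′ i ∸ n
  fδ-anti : Antitone fδ
  fδ-anti i j le = ℕP.∸-monoˡ-≤ m (part-antitone′ Pλ i j le)
  fγ-anti : Antitone fγ
  fγ-anti i j le = ℕP.∸-monoˡ-≤ n (part-antitone′ (conj-isPartition Pλ) i j le)

  δ γ : List ℕ
  δ = fromParts fδ n
  γ = fromParts fγ m
  Pδ : IsPartition δ
  Pδ = fromParts-isPartition fδ n fδ-anti
  Pγ : IsPartition γ
  Pγ = fromParts-isPartition fγ m fγ-anti

  δ+m≡L : ∀ j → 1 ≤ j → j ≤ n → part δ j + m ≡ L j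
  δ+m≡L j 1≤j jn = trans (cong (_+ m) (fromParts-part fδ n fδ-anti j 1≤j jn)) (ℕP.m∸n+n≡m (L≥m j 1≤j jn))

  γ+n≡λ′ : ∀ i → 1 ≤ i → i ≤ m → part γ i + n ≡ λ′ i
  γ+n≡λ′ i 1≤i im = trans (cong (_+ n) (fromParts-part fγ m fγ-anti i 1≤i im)) (ℕP.m∸n+n≡m (λ′≥n i 1≤i im))

  L[n+1]≤m : L (suc n) ≤ m
  L[n+1]≤m with ℕP.m≤n⇒m<n∨m≡n n≤b
  ... | inj₁ lt = ℕP.≤-trans (ℕP.≤-reflexive (link n a≤n lt)) μn<m
  ... | inj₂ e = ℕP.≤-trans (ℕP.≤-reflexive (above (suc n) (ℕP.≤-reflexive (cong suc (sym e))))) (ℕP.≤-trans (μ-anti n (suc n) 1≤n (ℕP.n≤1+n n)) (ℕP.<⇒≤ μn<m))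

  open CorrParts m n δ γ
  corr≡λ₀ : corr m n δ γ ≡ λ₀
  corr≡λ₀ = partExt (corr-isPartition Pδ Pγ (fromParts-length fγ m) 1≤m) Pλ e
    where
      e : ∀ j → 1 ≤ j → part (corr m n δ γ) j ≡ L j
      e j 1≤j with j ℕ.≤? n
      ... | yes jn = trans (corr-top j 1≤j jn) (trans (ℕP.+-comm m _) (δ+m≡L j 1≤j jn))
      ... | no njn = trans (cong (part (corr m n δ γ)) (sym js)) (trans (corr-bottom s 1≤s) (trans (≡-by-elements _ _ fw bw) (cong L js)))
        where
          s = j ∸ n
          js : n + s ≡ j
          js = ℕP.m+[n∸m]≡n (ℕP.<⇒≤ (ℕP.≰⇒> njn))
          1≤s : 1 ≤ s
          1≤s = ℕP.m<n⇒0<n∸m (ℕP.≰⇒> njn)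
          1≤ns = ℕP.≤-trans 1≤n (ℕP.m≤m+n n s)
          fw : ∀ i → 1 ≤ i → i ≤ part (conj γ) s → i ≤ L (n + s)
          fw i 1≤i le with proj₁ (conj-spec Pγ i s 1≤i 1≤s) le
          ... | sg with i ℕ.≤? m
          ...   | yes im = λ′⇒L i (n + s) 1≤i 1≤ns (subst (n + s ≤_) (trans (ℕP.+-comm n _) (γ+n≡λ′ i 1≤i im)) (ℕP.+-monoʳ-≤ n sg))
          ...   | no nim = ⊥-elim (ℕP.<-irrefl refl (ℕP.<-≤-trans 1≤s (subst (s ≤_) (fromParts-beyond fγ m i (ℕP.≰⇒> nim)) sg)))
          bw : ∀ i → 1 ≤ i → i ≤ L (n + s) → i ≤ part (conj γ) s
          bw i 1≤i le = proj₂ (conj-spec Pγ i s 1≤i 1≤s) (ℕP.+-cancelˡ-≤ n _ _ (subst (n + s ≤_) (sym (trans (ℕP.+-comm n _) (γ+n≡λ′ i 1≤i im))) (L⇒λ′ i (n + s) 1≤i 1≤ns le)))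
            where
              im : i ≤ m
              im = ℕP.≤-trans le (ℕP.≤-trans (L-anti (suc n) (n + s) (s≤s z≤n) (subst (_≤ n + s) (ℕP.+-comm n 1) (ℕP.+-monoʳ-≤ n 1≤s))) L[n+1]≤m)

  row-position : ∀ j → (j < a) ⊎ (a ≤ j × j ≤ b) ⊎ (b < j)
  row-position j with a ℕ.≤? j | j ℕ.≤? b
  ... | no p | _ = inj₁ (ℕP.≰⇒> p)
  ... | yes p | yes q = inj₂ (inj₁ (p , q))
  ... | yes p | no q = inj₂ (inj₂ (ℕP.≰⇒> q))

  -- the parameter of λ: the value inserted into α(l) + ρ_n at position a
  l : ℕ
  l = L a + (n ∸ a) ∸ m

  δ-insertion : Insertion n (part δ) (part μ) m l
  δ-insertion = record { a = a ; 1≤a = 1≤a ; a≤k = a≤n ; before = s1 ; after = s2 ; at = s3 }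
    where
      s1 : ∀ j → 1 ≤ j → j < a → part δ j + m ≡ part μ j
      s1 j 1≤j lt = trans (δ+m≡L j 1≤j (ℕP.≤-trans (ℕP.<⇒≤ lt) a≤n)) (below j 1≤j lt)
      s2 : ∀ j → a < j → j ≤ n → part δ j + m ≡ suc (part μ (j ∸ 1))
      s2 (suc j') lt jn = trans (δ+m≡L (suc j') (s≤s z≤n) jn) (link j' (ℕP.≤-pred lt) (ℕP.<-≤-trans jn n≤b))
      s3 : part δ a + (n ∸ a) ≡ l
      s3 = trans (cong (_+ (n ∸ a)) (fromParts-part fδ n fδ-anti a 1≤a a≤n)) (sym (ℕP.+-∸-comm (n ∸ a) (L≥m a 1≤a a≤n)))

  μb c : ℕ
  μb = part μ b
  c = suc μb
  c≤m : c ≤ m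
  c≤m = ℕP.≤-<-trans (μ-anti n b 1≤n n≤b) μn<m

  -- the columns of λ ∖ μ are c … λ_a; left of c the columns of λ and μ agree,
  -- right of c column i of λ reaches one row below column i - 1 of μ,
  -- and column c of λ ends in row b
  λ′-left : ∀ i → 1 ≤ i → i ≤ μb → λ′ i ≡ μ′ i
  λ′-left i 1≤i iμb = ≡-by-elements _ _ fw bw
    where
      fw : ∀ j → 1 ≤ j → j ≤ λ′ i → j ≤ μ′ i
      fw j 1≤j le = μ⇒μ′ i j 1≤i 1≤j (h (row-position j))
        where
          h : _ → i ≤ part μ j
          h (inj₁ lt) = subst (i ≤_) (below j 1≤j lt) (λ′⇒L i j 1≤i 1≤j le)
          h (inj₂ (inj₁ (aj , jb))) = ℕP.≤-trans iμb (μ-anti j b 1≤j jb)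
          h (inj₂ (inj₂ bj)) = subst (i ≤_) (above j bj) (λ′⇒L i j 1≤i 1≤j le)
      bw : ∀ j → 1 ≤ j → j ≤ μ′ i → j ≤ λ′ i
      bw j 1≤j le = L⇒λ′ i j 1≤i 1≤j (ℕP.≤-trans (μ′⇒μ i j 1≤i 1≤j le) (Rib.contained j))

  μ-short-below : ∀ i j → μb < i → b ≤ j → ¬ (i ≤ part μ j)
  μ-short-below i j μb<i bj i≤μj = ℕP.<-irrefl refl (ℕP.<-≤-trans μb<i (ℕP.≤-trans i≤μj (μ-anti b j (ℕP.≤-trans 1≤a a≤b) bj)))

  L-short-below : ∀ i j → μb < i → b < j → ¬ (i ≤ L j)
  L-short-below i j μb<i bj i≤Lj = μ-short-below i j μb<i (ℕP.<⇒≤ bj) (subst (i ≤_) (above j bj) i≤Lj)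

  λ′-right : ∀ i' → c < suc i' → suc i' ≤ m → λ′ (suc i') ≡ suc (μ′ i')
  λ′-right i' ci im = ≡-by-elements _ _ fw bw
    where
      μb<i' : μb < i'
      μb<i' = ℕP.≤-pred ci
      1≤i' = ℕP.≤-trans (s≤s z≤n) μb<i'
      fw : ∀ j → 1 ≤ j → j ≤ λ′ (suc i') → j ≤ suc (μ′ i')
      fw (suc zero) _ _ = s≤s z≤n
      fw (suc (suc j')) _ le = s≤s (μ⇒μ′ i' (suc j') 1≤i' (s≤s z≤n) (h (row-position (suc j'))))
        where
          j = suc j'
          Lle : suc i' ≤ L (suc j)
          Lle = λ′⇒L (suc i') (suc j) (s≤s z≤n) (s≤s z≤n) le
          h : _ → i' ≤ part μ j
          h (inj₁ lt) = ℕP.≤-trans (ℕP.n≤1+n i')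
            (ℕP.≤-trans Lle (subst (L (suc j) ≤_) (below j (s≤s z≤n) lt) (L-anti j (suc j) (s≤s z≤n) (ℕP.n≤1+n j))))
          h (inj₂ (inj₁ (aj , jb))) with ℕP.m≤n⇒m<n∨m≡n jb
          ... | inj₁ jb' = ℕP.≤-pred (subst (suc i' ≤_) (link j aj jb') Lle)
          ... | inj₂ j≡b = ⊥-elim (L-short-below (suc i') (suc j) (ℕP.m<n⇒m<1+n μb<i') (subst (_< suc j) j≡b (ℕP.n<1+n j)) Lle)
          h (inj₂ (inj₂ bj)) = ⊥-elim (L-short-below (suc i') (suc j) (ℕP.m<n⇒m<1+n μb<i') (ℕP.m<n⇒m<1+n bj) Lle)
      bw : ∀ j → 1 ≤ j → j ≤ suc (μ′ i') → j ≤ λ′ (suc i')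
      bw (suc zero) _ _ = L⇒λ′ (suc i') 1 (s≤s z≤n) (s≤s z≤n) (ℕP.≤-trans im (L≥m 1 (s≤s z≤n) 1≤n))
      bw (suc (suc j')) _ (s≤s le) = L⇒λ′ (suc i') (suc j) (s≤s z≤n) (s≤s z≤n) (h (row-position j))
        where
          j = suc j'
          iμ : i' ≤ part μ j
          iμ = μ′⇒μ i' j 1≤i' (s≤s z≤n) le
          h : _ → suc i' ≤ L (suc j)
          h (inj₁ lt) = ℕP.≤-trans im (L≥m (suc j) (s≤s z≤n) (ℕP.≤-trans lt a≤n))
          h (inj₂ (inj₁ (aj , jb))) with ℕP.m≤n⇒m<n∨m≡n jb
          ... | inj₁ jb' = subst (suc i' ≤_) (sym (link j aj jb')) (s≤s iμ)
          ... | inj₂ j≡b = ⊥-elim (μ-short-below i' j μb<i' (ℕP.≤-reflexive (sym j≡b)) iμ)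
          h (inj₂ (inj₂ bj)) = ⊥-elim (μ-short-below i' j μb<i' (ℕP.<⇒≤ bj) iμ)

  λ′c≡b : λ′ c ≡ b
  λ′c≡b = ≡-by-elements _ _ fw bw
    where
      fw : ∀ j → 1 ≤ j → j ≤ λ′ c → j ≤ b
      fw j 1≤j le = ℕP.≮⇒≥ λ bj → ℕP.<-irrefl refl (ℕP.<-≤-trans (s≤s (μ-anti b j (ℕP.≤-trans 1≤a a≤b) (ℕP.<⇒≤ bj)))
                       (subst (c ≤_) (above j bj) (λ′⇒L c j (s≤s z≤n) 1≤j le)))
      bw : ∀ j → 1 ≤ j → j ≤ b → j ≤ λ′ c
      bw j 1≤j jb = L⇒λ′ c j (s≤s z≤n) 1≤j (ℕP.≤-trans (RowRibbon.inside rowRibbon b a≤b ℕP.≤-refl) (L-anti j b 1≤j jb))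

  -- Size bookkeeping: with e = λ_a - m, u = m - c, v = n - a, w = b - n,
  -- r = λ_a - μ_b + (b - a) = 1 + (e + v) + (w + u) and l = e + v.
  e u v w : ℕ
  e = L a ∸ m
  u = m ∸ c
  v = n ∸ a
  w = b ∸ n

  La≡ : L a ≡ e + m
  La≡ = sym (ℕP.m∸n+n≡m (L≥m a 1≤a a≤n))
  m≡ : m ≡ u + c
  m≡ = sym (ℕP.m∸n+n≡m c≤m)

  λa∸μb≡ : L a ∸ μb ≡ suc (e + u)
  λa∸μb≡ = trans (cong (_∸ μb) (trans La≡ (trans (cong (e +_) m≡) (arith e u μb)))) (ℕP.m+n∸n≡m _ μb)
    where
      arith : ∀ e u μ → e + (u + suc μ) ≡ suc (e + u) + μ
      arith = solve-∀
  b∸a≡ : b ∸ a ≡ w + v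
  b∸a≡ = trans (cong (_∸ a) (trans (sym (ℕP.m∸n+n≡m n≤b)) (trans (cong (w +_) (sym (ℕP.m∸n+n≡m a≤n))) (sym (ℕP.+-assoc w v a))))) (ℕP.m+n∸n≡m _ a)
  l≡e+v : l ≡ e + v
  l≡e+v = trans (cong (λ z → z + v ∸ m) La≡) (trans (cong (_∸ m) (trans (ℕP.+-assoc e m v) (trans (cong (e +_) (ℕP.+-comm m v)) (sym (ℕP.+-assoc e v m))))) (ℕP.m+n∸n≡m _ m))

  r≡ : r ≡ suc (l + (w + u))
  r≡ = trans (sym size≡r) (trans (cong₂ _+_ λa∸μb≡ b∸a≡) (trans (arith e u w v) (cong (λ z → suc (z + (w + u))) (sym l≡e+v))))
    where
      arith : ∀ e u w v → suc (e + u) + (w + v) ≡ suc ((e + v) + (w + u))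
      arith = solve-∀

  l<r : l < r
  l<r = subst (l <_) (sym r≡) (s≤s (ℕP.m≤m+n l _))

  γ-insertion : Insertion m (part γ) μ′ n (r ∸ 1 ∸ l)
  γ-insertion = record { a = c ; 1≤a = s≤s z≤n ; a≤k = c≤m ; before = s1 ; after = s2 ; at = s3 }
    where
      s1 : ∀ i → 1 ≤ i → i < c → part γ i + n ≡ μ′ i
      s1 i 1≤i lt = trans (γ+n≡λ′ i 1≤i (ℕP.≤-trans (ℕP.<⇒≤ lt) c≤m)) (λ′-left i 1≤i (ℕP.≤-pred lt))
      s2 : ∀ i → c < i → i ≤ m → part γ i + n ≡ suc (μ′ (i ∸ 1))
      s2 (suc i') lt im = trans (γ+n≡λ′ (suc i') (s≤s z≤n) im) (λ′-right i' lt im)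
      s3 : part γ c + (m ∸ c) ≡ r ∸ 1 ∸ l
      s3 = trans (cong (_+ u) (trans (fromParts-part fγ m fγ-anti c (s≤s z≤n) c≤m) (cong (_∸ n) λ′c≡b)))
             (sym (trans (cong (λ z → z ∸ 1 ∸ l) r≡) (ℕP.m+n∸m≡n l (w + u))))


module Signs where

  open import Data.Nat as ℕ using (zero; suc; _+_)
  open import Data.Integer as ℤ using (+_; -_)
  import Data.Integer.Properties as ℤP
  open import Data.Integer.Tactic.RingSolver using (solve-∀)
  open import Relation.Binary.PropositionalEquality

  signPow-+ : ∀ x y → signPow (x + y) ≡ signPow x * signPow y
  signPow-+ zero y = sym (ℤP.*-identityˡ (signPow y))
  signPow-+ (suc x) y = trans (cong -_ (signPow-+ x y)) (ℤP.neg-distribˡ-* (signPow x) (signPow y))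

  signPow-square : ∀ x → signPow x * signPow x ≡ + 1
  signPow-square zero = refl
  signPow-square (suc x) = trans (neg-square (signPow x)) (signPow-square x)
    where
      neg-square : ∀ (a : ℤ) → (- a) * (- a) ≡ a * a
      neg-square = solve-∀

  signPow-exchange : ∀ v u g → signPow v * signPow u ≡ signPow (g + u) * signPow (v + g)
  signPow-exchange v u g = sym (begin
    signPow (g + u) * signPow (v + g)                   ≡⟨ cong₂ _*_ (signPow-+ g u) (signPow-+ v g) ⟩
    (signPow g * signPow u) * (signPow v * signPow g)   ≡⟨ regroup (signPow v) (signPow u) (signPow g) ⟩
    (signPow v * signPow u) * (signPow g * signPow g)   ≡⟨ cong ((signPow v * signPow u) *_) (signPow-square g) ⟩
    (signPow v * signPow u) * + 1                       ≡⟨ ℤP.*-identityʳ _ ⟩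
    signPow v * signPow u                               ∎)
    where
      open ≡-Reasoning
      regroup : ∀ (sv su sg : ℤ) → (sg * su) * (sv * sg) ≡ (sv * su) * (sg * sg)
      regroup = solve-∀

module Correspondence (m' n' r : ℕ) (1≤r : 1 ≤ r) (μ : List ℕ) (Pμ : IsPartition μ) (μn<m : part μ (suc n') < suc m') where

  open Insertions using (Insertion; module Staircase)
  open Partitions
  open Conjugates
  open CorrMap
  open Signs
  open import Data.Nat using (_+_)
  import Data.Nat.Properties as ℕP
  open import Data.Product using (proj₁; proj₂)
  open import Relation.Binary.PropositionalEquality

  m n : ℕ
  m = suc m'
  n = suc n'

  1≤m : 1 ≤ m
  1≤m = s≤s z≤n
  1≤n : 1 ≤ n
  1≤n = s≤s z≤n

  module Δ {δ} (Pδ : IsPartition δ) (l : ℕ) =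
    Staircase n' (part δ) (part μ) m l (part-antitone′ Pδ) (part-antitone′ Pμ)
  module Γ {γ} (Pγ : IsPartition γ) (l : ℕ) =
    Staircase m' (part γ) (part (conj μ)) n (r ∸ 1 ∸ l) (part-antitone′ Pγ) (part-antitone′ (conj-isPartition Pμ))

  module ForwardOf {l δ γ} (pair : PairL m n r μ l δ γ) where
    Pδ : IsPartition δ
    Pδ = proj₁ pair
    Pγ : IsPartition γ
    Pγ = proj₁ (proj₂ pair)
    condition : CondL m n r μ l δ γ
    condition = proj₂ (proj₂ (proj₂ (proj₂ (proj₂ pair))))
    Iδ : Insertion n (part δ) (part μ) m l
    Iδ = Δ.insertion-of-rearrangement Pδ l (proj₁ (proj₁ condition)) (proj₂ (proj₁ condition))
    Iγ : Insertion m (part γ) (part (conj μ)) n (r ∸ 1 ∸ l)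
    Iγ = Γ.insertion-of-rearrangement Pγ l (proj₁ (proj₂ condition)) (proj₂ (proj₂ condition))
    open Forward m n r 1≤m 1≤n μ Pμ μn<m δ γ Pδ Pγ (proj₁ (proj₂ (proj₂ pair))) (proj₁ (proj₂ (proj₂ (proj₂ pair))))
                 l (proj₁ (proj₂ (proj₂ (proj₂ (proj₂ pair))))) Iδ Iγ public

  into-target : (δ γ : List ℕ) → InDomain m n r μ δ γ → InTarget m n r μ (corr m n δ γ)
  into-target δ γ (l , pair) = ForwardOf.target pair

  injective : (δ γ δ₁ γ₁ : List ℕ) → InDomain m n r μ δ γ → InDomain m n r μ δ₁ γ₁ →
    corr m n δ γ ≡ corr m n δ₁ γ₁ → δ ≡ δ₁ × γ ≡ γ₁
  injective δ γ δ₁ γ₁ (_ , Pδ , Pγ , lδ , _) (_ , Pδ₁ , Pγ₁ , lδ₁ , _) = corr-injective m n Pδ Pγ Pδ₁ Pγ₁ lδ lδ₁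

  onto-target : (λ₀ : List ℕ) → InTarget m n r μ λ₀ →
    Σ (List ℕ) λ δ → Σ (List ℕ) λ γ → InDomain m n r μ δ γ × corr m n δ γ ≡ λ₀
  onto-target λ₀ (Pλ , ribbon , m≤λn) =
    B.δ , B.γ ,
    (B.l , B.Pδ , B.Pγ , fromParts-length B.fδ n , fromParts-length B.fγ m , B.l<r ,
     Δ.FromInsertion.rearrangement-of-insertion B.Pδ B.l B.δ-insertion ,
     Γ.FromInsertion.rearrangement-of-insertion B.Pγ B.l B.γ-insertion) ,
    B.corr≡λ₀
    where module B = Backward m n r 1≤m 1≤n 1≤r μ Pμ μn<m λ₀ Pλ ribbon m≤λn

  -- sign σ = (-1)^(n-a), sign τ = (-1)^(m-c), and with γ_c + (m - c) = r - 1 - l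
  -- and ht = (n - a) + γ_c the common summand γ_c cancels
  sign-formula : (l : ℕ) (δ γ : List ℕ) → PairL m n r μ l δ γ →
    (σ : Permutation′ n) (τ : Permutation′ m) → Sorts (αρ m n μ l) σ → Sorts (βρ m n r μ l) τ →
    sign σ * sign τ ≡ signPow (r ∸ 1 ∸ l) * signPow (ht μ (corr m n δ γ))
  sign-formula l δ γ pair σ τ σ-sorts τ-sorts = begin
    signPow (inversions σ) * signPow (inversions τ) ≡⟨ cong₂ (λ x y → signPow x * signPow y) inv-σ inv-τ ⟩
    signPow (n ∸ a) * signPow (m ∸ c)                 ≡⟨ signPow-exchange (n ∸ a) (m ∸ c) (part γ c) ⟩
    signPow (part γ c + (m ∸ c)) * signPow ((n ∸ a) + part γ c)
      ≡⟨ cong₂ (λ x y → signPow x * signPow y) (Insertion.at F.Iγ) (sym (trans F.height (ℕP.+-∸-comm (part γ c) (Insertion.a≤k F.Iδ)))) ⟩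
    signPow (r ∸ 1 ∸ l) * signPow (ht μ (corr m n δ γ)) ∎
    where
      open ≡-Reasoning
      module F = ForwardOf pair
      a c : ℕ
      a = Insertion.a F.Iδ
      c = Insertion.a F.Iγ
      inv-σ : inversions σ ≡ n ∸ a
      inv-σ = Δ.FromInsertion.inversions-of-sorting F.Pδ l F.Iδ σ σ-sorts
      inv-τ : inversions τ ≡ m ∸ c
      inv-τ = Γ.FromInsertion.inversions-of-sorting F.Pγ l F.Iγ τ τ-sorts

mainTheorem17 : (m n r : ℕ) → 1 ≤ m → 1 ≤ n → 1 ≤ r →
    (μ : List ℕ) → IsPartition μ → part μ n < m →
    ((δ γ : List ℕ) → InDomain m n r μ δ γ → InTarget m n r μ (corr m n δ γ))
    × ((δ γ δ₁ γ₁ : List ℕ) → InDomain m n r μ δ γ → InDomain m n r μ δ₁ γ₁ →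
         corr m n δ γ ≡ corr m n δ₁ γ₁ → (δ ≡ δ₁ × γ ≡ γ₁))
    × ((λ₀ : List ℕ) → InTarget m n r μ λ₀ →
         Σ (List ℕ) λ δ → Σ (List ℕ) λ γ → InDomain m n r μ δ γ × corr m n δ γ ≡ λ₀)
    × ((l : ℕ) (δ γ : List ℕ) → PairL m n r μ l δ γ →
         (σ : Permutation′ n) (τ : Permutation′ m) →
         Sorts (αρ m n μ l) σ → Sorts (βρ m n r μ l) τ →
         sign σ * sign τ ≡ signPow (r ∸ 1 ∸ l) * signPow (ht μ (corr m n δ γ)))
mainTheorem17 (suc m') (suc n') r (s≤s z≤n) (s≤s z≤n) 1≤r μ Pμ μn<m =
  into-target , injective , onto-target , sign-formula
  where open Correspondence m' n' r 1≤r μ Pμ μn<m
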